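{- Let $n\ge 3$. For a configuration $c$ that is recurrent for the SSM on the wheel graph $W_n$, let $\mathcal{O}=\mathcal{O}(m(c))$ and let $M$ be the set of vertices $i\in[n]$ such that $c_i=2$ but $i$ is not a cyclically first maximal vertex of $c$. Define the subgraph $G(c)=(A,E_A)$ of $C_n$ by $A=\{i\in[n] : \text{the edge }\{i,i+1\}\text{ is oriented } i+1\to i \text{ in } \mathcal{O}\}$ and $E_A=\{\{i-1,i\} : i\in M\}$ (indices modulo $n$). Then $c\mapsto G(c)$ is a bijection from the set of recurrent configurations for the SSM on $W_n$ to the set $\mathrm{Sub}(C_n)$ of subgraphs of $C_n$. Moreover, for every such $c$, $\mathrm{level}(c)$ equals the number of edges of $G(c)$, and $\mathrm{weight}^{01^*}(c)$ equals the number of vertices of $C_n$ that are not in $G(c)$.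
   Context: The cycle graph $C_n$ has vertex set $[n]=\{1,\dots,n\}$ and edges $\{i,i+1\}$ ($i\in[n-1]$) and $\{n,1\}$; cycle vertices are indexed modulo $n$ (so $n+1$ means $1$ and $1-1$ means $n$). The wheel graph $W_n$ has vertex set $\{0,1,\dots,n\}$, the edges of $C_n$, and an edge $\{0,i\}$ for every $i\in[n]$; vertex $0$ is the sink. The vertices $1,\dots,n$ are thought of as arranged clockwise; an edge $\{i,i+1\}$ oriented $i\to i+1$ is clockwise, oriented $i+1\to i$ counter-clockwise. For $i\neq j$ in $[n]$, the open cyclic interval $(i,j)$ is the set of vertices strictly between $i$ and $j$ going clockwise from $i$ ($i+1,i+2,\dots,j-1$ modulo $n$); $(i,i):=[n]\setminus\{i\}$. Sandpile models: a configuration on $W_n$ is $c=(c_1,\dots,c_n)\in\mathbb{Z}_{\ge0}^n$ ($c_i$ grains at vertex $i$, none at the sink); it is stable if $c_i<\deg(i)=3$ for all $i$. In the stochastic sandpile model (SSM) with fixed parameter $p\in(0,1)$, an unstable vertex $i$ topples as follows: for each neighbour $j$ of $i$ independently, with probability $p$ one grain moves from $i$ to $j$ (and is lost if $j=0$), otherwise it stays at $i$. Repeatedly toppling unstable vertices stabilises any configuration. Fix a probability distribution $\mu$ on $[n]$ with all $\mu_i>0$; the SSM Markov chain on stable configurations adds one grain at vertex $i$ with probability $\mu_i$ and then stabilises. A configuration is recurrent for the SSM if it is a recurrent state of this chain. For configurations, $c\preceq c'$ means $c_i\le c'_i$ for all $i$; a configuration is minimal recurrent if it is recurrent and minimal for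 $\preceq$ among recurrent ones. The level of $c$ is $\mathrm{level}(c)=\sum_i c_i+\deg(0)-|E(W_n)|=\sum_i c_i-n$. For $c$ recurrent for the SSM on $W_n$: a vertex $i$ is a cyclically first maximal vertex if $c_i=2$ and there is $j\in[n]$ with $c_j=0$ and $c_k=1$ for all $k\in(j,i)$. A $01^*$-chain of $c$ is a set of cyclically consecutive vertices $j,j+1,\dots,j+k$ ($k\ge0$) with $c_j=0$ and $c_{j'}=1$ for $j<j'\le j+k$; $\mathrm{weight}^{01^*}(c)$ is the number of vertices belonging to some $01^*$-chain. The configuration $m(c)$ is defined by $m(c)_i=0$ if $c_i=0$, $m(c)_i=2$ if $i$ is a cyclically first maximal vertex, and $m(c)_i=1$ otherwise; it is minimal recurrent for the SSM. For a minimal recurrent configuration $c'$ of the SSM on $W_n$, $\mathcal{O}(c')$ denotes: the counter-clockwise directed cycle ($i+1\to i$ for all $i$) if $c'=(1,\dots,1)$, and otherwise the unique orientation of $C_n$ in which every vertex $i$ has in-degree exactly $c'_i$. A subgraph of $C_n$ is a pair $(A,E_A)$ with $A$ a non-empty subset of $[n]$ and $E_A$ a set of edges of $C_n$ with both endpoints in $A$; $\mathrm{Sub}(C_n)$ is the set of these. -}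

module Defs where

open import Data.Nat using (ℕ; zero; suc; _+_; _∸_; _<_; _≤_; _<?_)
open import Data.Nat.DivMod using (_%_; m%n<n)
import Data.Nat as ℕ
open import Data.Integer using (ℤ; +_; _-_)
open import Data.Fin using (Fin; toℕ; fromℕ<) renaming (_≟_ to _≟ᶠ_)
open import Data.Fin.Properties using (any?; all?)
open import Data.Fin.Subset using (Subset; _∈_; Nonempty; ∣_∣)
open import Data.Bool using (Bool; true; false; if_then_else_)
open import Data.Vec using (Vec; []; _∷_; lookup; tabulate; replicate; sum)
open import Data.Vec.Properties using (≡-dec)
open import Data.List as List using (List; filter; head)
open import Data.Maybe using (just; nothing)
open import Data.Product using (Σ; ∃; _×_; _,_)
open import Data.Sum using (_⊎_)
open import Relation.Nullary using (¬_; Dec; does)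
open import Relation.Nullary.Decidable using (_×-dec_; _⊎-dec_; _→-dec_; ¬?)
open import Relation.Binary.PropositionalEquality using (_≡_; _≢_)
open import Relation.Binary.Construct.Closure.ReflexiveTransitive using (Star)

-- Vertices of C_n are Fin n; paper vertex i ∈ [n] is Fin element i-1.
-- Cyclic successor / predecessor (indices modulo n).

next : ∀ {n} → Fin n → Fin n
next {suc m} i = fromℕ< (m%n<n (suc (toℕ i)) (suc m))

prev : ∀ {n} → Fin n → Fin n
prev {suc m} i = fromℕ< (m%n<n (toℕ i + m) (suc m))

cdist : ∀ {n} → Fin n → Fin n → ℕ
cdist {suc m} j k = (toℕ k + suc m ∸ toℕ j) % suc m

-- k lies in the open cyclic interval (j , i):
--   j ≠ i : vertices j+1, …, i-1 clockwise;   j = i : [n] \ {i}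
InOpen : ∀ {n} → Fin n → Fin n → Fin n → Set
InOpen j i k = (j ≡ i × k ≢ i) ⊎ (j ≢ i × (0 < cdist j k × cdist j k < cdist j i))

inOpen? : ∀ {n} (j i k : Fin n) → Dec (InOpen j i k)
inOpen? j i k = ((j ≟ᶠ i) ×-dec ¬? (k ≟ᶠ i))
           ⊎-dec (¬? (j ≟ᶠ i) ×-dec ((0 <? cdist j k) ×-dec (cdist j k <? cdist j i)))

-- Configurations on W_n (sink 0 carries no grains)

Config : ℕ → Set
Config n = Vec ℕ n

Stable : ∀ {n} → Config n → Set
Stable c = ∀ i → lookup c i < 3

ind : Bool → ℕ
ind true = 1
ind false = 0

-- Toppling of vertex i of W_n: grain to i-1 iff a, to i+1 iff b, to the sink iff s.
topple : ∀ {n} → Config n → Fin n → Bool → Bool → Bool → Config n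
topple c i a b s = tabulate λ k →
  lookup c k
  + (if does (k ≟ᶠ prev i) then ind a else 0)
  + (if does (k ≟ᶠ next i) then ind b else 0)
  ∸ (if does (k ≟ᶠ i) then ind a + ind b + ind s else 0)

-- one toppling of some unstable vertex, with some outcome
-- (every outcome has positive probability since 0 < p < 1)
ToppleStep : ∀ {n} → Config n → Config n → Set
ToppleStep {n} c d = Σ (Fin n) λ i → 3 ≤ lookup c i ×
  Σ Bool λ a → Σ Bool λ b → Σ Bool λ s → d ≡ topple c i a b s

Stabilises : ∀ {n} → Config n → Config n → Set
Stabilises c d = Star ToppleStep c d × Stable d

addGrain : ∀ {n} → Config n → Fin n → Config n
addGrain c i = tabulate λ k → lookup c k + (if does (k ≟ᶠ i) then 1 else 0)

-- transition of the SSM Markov chain with positive probability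
-- (μ_i > 0 for all i)
ChainStep : ∀ {n} → Config n → Config n → Set
ChainStep {n} c d = Stable c × Σ (Fin n) λ i → Stabilises (addGrain c i) d

Reach : ∀ {n} → Config n → Config n → Set
Reach = Star ChainStep

-- recurrent state of the finite Markov chain: every state reachable
-- from c leads back to c
Recurrent : ∀ {n} → Config n → Set
Recurrent c = Stable c × (∀ d → Reach c d → Reach d c)

level : ∀ {n} → Config n → ℤ
level {n} c = + sum c - + n

CFM : ∀ {n} → Config n → Fin n → Set
CFM c i = lookup c i ≡ 2 × ∃ λ j → lookup c j ≡ 0 ×
            (∀ k → InOpen j i k → lookup c k ≡ 1)

cfm? : ∀ {n} (c : Config n) (i : Fin n) → Dec (CFM c i)
cfm? c i = (lookup c i ℕ.≟ 2) ×-dec any? λ j → (lookup c j ℕ.≟ 0) ×-dec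
             all? λ k → inOpen? j i k →-dec (lookup c k ℕ.≟ 1)

mconf : ∀ {n} → Config n → Config n
mconf c = tabulate λ i →
  if does (lookup c i ℕ.≟ 0) then 0 else (if does (cfm? c i) then 2 else 1)

InM : ∀ {n} → Config n → Fin n → Set
InM c i = lookup c i ≡ 2 × ¬ CFM c i

inM? : ∀ {n} (c : Config n) (i : Fin n) → Dec (InM c i)
inM? c i = (lookup c i ℕ.≟ 2) ×-dec ¬? (cfm? c i)

-- Orientations of C_n: o[i] = true iff the edge {i,i+1} is oriented i+1 → i
-- (counter-clockwise), false iff oriented i → i+1.

Orientation : ℕ → Set
Orientation n = Vec Bool n

indeg : ∀ {n} → Orientation n → Fin n → ℕ
indeg o i = ind (lookup o i) + (if lookup o (prev i) then 0 else 1)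

allOrientations : ∀ n → List (Orientation n)
allOrientations zero = [] List.∷ List.[]
allOrientations (suc n) =
  List.map (true ∷_) (allOrientations n) List.++ List.map (false ∷_) (allOrientations n)

HasIndegrees : ∀ {n} → Config n → Orientation n → Set
HasIndegrees c o = tabulate (indeg o) ≡ c

-- 𝒪(c'): counter-clockwise cycle if c' = (1,…,1); otherwise the (unique)
-- orientation with in-degrees c' (found by exhaustive search; the default
-- value is never used for minimal recurrent c').
𝒪 : ∀ {n} → Config n → Orientation n
𝒪 {n} c' with does (≡-dec ℕ._≟_ c' (replicate n 1))
... | true = replicate n true
... | false with head (filter (λ o → ≡-dec ℕ._≟_ (tabulate (indeg o)) c') (allOrientations n))
...   | just o = o
...   | nothing = replicate n true

-- Subgraphs of C_n: (A , E_A), vertex set A ⊆ [n] and edge set given by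
-- the subset of indices e, where e stands for the edge {e, e+1}.

IsSubgraph : ∀ {n} → Subset n × Subset n → Set
IsSubgraph {n} (A , E) = Nonempty A × (∀ e → e ∈ E → e ∈ A × next e ∈ A)

-- G(c) = (A , E_A); A = {i : {i,i+1} oriented i+1 → i in 𝒪(m(c))},
-- E_A = {{i-1,i} : i ∈ M}, i.e. edge e ∈ E_A iff e+1 ∈ M.
G : ∀ {n} → Config n → Subset n × Subset n
G c = 𝒪 (mconf c) , tabulate λ e → does (inM? c (next e))

InChain : ∀ {n} → Config n → Fin n → Set
InChain c v = ∃ λ j → lookup c j ≡ 0 ×
  (v ≡ j ⊎ (lookup c v ≡ 1 × (∀ k → InOpen j v k → lookup c k ≡ 1)))

inChain? : ∀ {n} (c : Config n) (v : Fin n) → Dec (InChain c v)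
inChain? c v = any? λ j → (lookup c j ℕ.≟ 0) ×-dec ((v ≟ᶠ j) ⊎-dec
  ((lookup c v ℕ.≟ 1) ×-dec all? λ k → inOpen? j v k →-dec (lookup c k ℕ.≟ 1)))

weight01 : ∀ {n} → Config n → ℕ
weight01 c = ∣ tabulate (λ v → does (inChain? c v)) ∣

{-# OPTIONS --safe #-}
module Submission where

-- A stable configuration c is recurrent iff c ≥ indeg o pointwise for some orientation o of C_n.
-- Adding a grain preserves this, and so does toppling once the edges along which grains are sent
-- are reversed; every stable configuration reaches the all-2 configuration, and conversely the
-- all-2 configuration reaches every such c, since c always has a stable dominating predecessor
-- with more grains (a vertex raised to 2 whose extra grain topples away into the sink).
-- For such c every 0 is followed clockwise by a run of 1s and then a 2. Hence orienting {q, q+1}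
-- towards q exactly when q lies on no 01*-chain gives in-degrees m(c). If m(c) has a 0, that 0
-- fixes one edge and in-degrees propagate around the cycle, so this is the only such orientation;
-- otherwise there are no chains and it is the counter-clockwise cycle. Either way it is 𝒪(m(c)).
-- As c = m(c) + 1_M, c is recovered from G(c) = (A , E_A) as c_q = indeg_A(q) + [{q-1, q} ∈ E_A].
-- For an arbitrary subgraph this formula gives a stable configuration dominating A, hence a
-- recurrent one, which G maps back to the subgraph. Summing the formula gives level(c) = |E_A|,
-- and the vertices outside A are those on 01*-chains.

open import Defs

open import Data.Bool using (Bool; true; false; not; _∧_; _∨_; if_then_else_)
open import Data.Bool.Properties using (not-involutive)
open import Data.Empty using (⊥-elim)
open import Data.Fin using (Fin; toℕ; zero; suc) renaming (_≟_ to _≟ᶠ_)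
open import Data.Fin.Permutation using (permutation)
open import Data.Fin.Properties using (toℕ-fromℕ<; toℕ-injective; toℕ<n; all?; any?; ¬∀⟶∃¬)
open import Data.Fin.Subset using (Subset; ∣_∣; ∁; _∈_; Nonempty)
import Data.Integer as ℤ
import Data.Integer.Properties as ℤ
open import Data.List as List using (filter)
open import Data.List.Membership.Propositional using () renaming (_∈_ to _∈ˡ_)
open import Data.List.Membership.Propositional.Properties
  using (∈-++⁺ˡ; ∈-++⁺ʳ; ∈-map⁺; ∈-filter⁺; ∈-filter⁻)
open import Data.List.Relation.Unary.Any using (here)
open import Data.Nat using (ℕ; zero; suc; _+_; _*_; _∸_; _<_; _≤_; z≤n; s≤s; z<s; _%_) renaming (_≟_ to _≟ℕ_)
open import Data.Nat.DivMod using (%-distribˡ-+; m%n%n≡m%n; [m+n]%n≡m%n; m<n⇒m%n≡m; m%n<n)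
open import Data.Nat.Induction using (<-rec)
open import Data.Nat.Properties
open import Algebra.Properties.CommutativeMonoid.Sum +-0-commutativeMonoid
  using (sum-cong-≗; ∑-distrib-+; ∑-permute) renaming (sum to ∑)
open import Data.Nat.Solver using (module +-*-Solver)
open import Algebra.Properties.CommutativeSemigroup +-commutativeSemigroup using (xy∙z≈xz∙y; xy∙z≈zy∙x)
open import Data.Product using (Σ; ∃; ∃-syntax; _×_; _,_; proj₁; proj₂)
open import Data.Sum using (_⊎_; inj₁; inj₂)
open import Data.Vec using (Vec; []; _∷_; lookup; tabulate; replicate; sum; _[_]≔_)
open import Data.Vec.Properties
  using (≡-dec; tabulate∘lookup; tabulate-cong; lookup∘tabulate; lookup∘update; lookup∘update′;
         lookup-replicate; lookup-map; []=⇒lookup; lookup⇒[]=)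
open import Function using (_∘_)
open import Relation.Binary.Construct.Closure.ReflexiveTransitive using (Star; ε; _◅_; _◅◅_)
open import Relation.Binary.PropositionalEquality
open import Relation.Nullary using (¬_; Dec; yes; no; does)
open import Relation.Nullary.Decidable using (dec-true; dec-false; decidable-stable; ¬?)
open import Relation.Unary using (Pred; Decidable)

-- The cycle C_n

module _ {m : ℕ} where

  private
    n : ℕ
    n = suc m

    [a%n+b]%n : ∀ a b → (a % n + b) % n ≡ (a + b) % n
    [a%n+b]%n a b = begin
      (a % n + b) % n             ≡⟨ %-distribˡ-+ (a % n) b n ⟩
      (a % n % n + b % n) % n     ≡⟨ cong (λ x → (x + b % n) % n) (m%n%n≡m%n a n) ⟩
      (a % n + b % n) % n         ≡⟨ %-distribˡ-+ a b n ⟨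
      (a + b) % n                 ∎
      where open ≡-Reasoning

    [a+b%n]%n : ∀ a b → (a + b % n) % n ≡ (a + b) % n
    [a+b%n]%n a b = begin
      (a + b % n) % n  ≡⟨ cong (_% n) (+-comm a (b % n)) ⟩
      (b % n + a) % n  ≡⟨ [a%n+b]%n b a ⟩
      (b + a) % n      ≡⟨ cong (_% n) (+-comm b a) ⟩
      (a + b) % n      ∎
      where open ≡-Reasoning

    [i+n]%n≡i : (i : Fin n) → (toℕ i + n) % n ≡ toℕ i
    [i+n]%n≡i i = trans ([m+n]%n≡m%n (toℕ i) n) (m<n⇒m%n≡m (toℕ<n i))

  toℕ-next : (i : Fin n) → toℕ (next i) ≡ suc (toℕ i) % n
  toℕ-next i = toℕ-fromℕ< _

  toℕ-prev : (i : Fin n) → toℕ (prev i) ≡ (toℕ i + m) % n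
  toℕ-prev i = toℕ-fromℕ< _

  prev-next : (i : Fin n) → prev (next i) ≡ i
  prev-next i = toℕ-injective (begin
    toℕ (prev (next i))        ≡⟨ toℕ-prev (next i) ⟩
    (toℕ (next i) + m) % n     ≡⟨ cong (λ x → (x + m) % n) (toℕ-next i) ⟩
    (suc (toℕ i) % n + m) % n  ≡⟨ [a%n+b]%n (suc (toℕ i)) m ⟩
    suc (toℕ i + m) % n        ≡⟨ cong (_% n) (+-suc (toℕ i) m) ⟨
    (toℕ i + n) % n            ≡⟨ [i+n]%n≡i i ⟩
    toℕ i                      ∎)
    where open ≡-Reasoning

  next-prev : (i : Fin n) → next (prev i) ≡ i
  next-prev i = toℕ-injective (begin
    toℕ (next (prev i))        ≡⟨ toℕ-next (prev i) ⟩
    suc (toℕ (prev i)) % n     ≡⟨ cong (λ x → suc x % n) (toℕ-prev i) ⟩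
    (1 + (toℕ i + m) % n) % n  ≡⟨ [a+b%n]%n 1 (toℕ i + m) ⟩
    suc (toℕ i + m) % n        ≡⟨ cong (_% n) (+-suc (toℕ i) m) ⟨
    (toℕ i + n) % n            ≡⟨ [i+n]%n≡i i ⟩
    toℕ i                      ∎)
    where open ≡-Reasoning

  prev-injective : {i j : Fin n} → prev i ≡ prev j → i ≡ j
  prev-injective {i} {j} eq = trans (sym (next-prev i)) (trans (cong next eq) (next-prev j))

  walk : Fin n → ℕ → Fin n
  walk j zero    = j
  walk j (suc t) = next (walk j t)

  toℕ-walk : ∀ j t → toℕ (walk j t) ≡ (toℕ j + t) % n
  toℕ-walk j zero    = sym (trans (cong (_% n) (+-identityʳ (toℕ j))) (m<n⇒m%n≡m (toℕ<n j)))
  toℕ-walk j (suc t) = begin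
    toℕ (next (walk j t))        ≡⟨ toℕ-next (walk j t) ⟩
    suc (toℕ (walk j t)) % n     ≡⟨ cong (λ x → suc x % n) (toℕ-walk j t) ⟩
    (1 + (toℕ j + t) % n) % n    ≡⟨ [a+b%n]%n 1 (toℕ j + t) ⟩
    suc (toℕ j + t) % n          ≡⟨ cong (_% n) (+-suc (toℕ j) t) ⟨
    (toℕ j + suc t) % n          ∎
    where open ≡-Reasoning

  private
    cdist-unfold : (j x : Fin n) → cdist j x ≡ (toℕ x + (n ∸ toℕ j)) % n
    cdist-unfold j x = cong (_% n) (+-∸-assoc (toℕ x) (<⇒≤ (toℕ<n j)))

  cdist<n : (j x : Fin n) → cdist j x < n
  cdist<n j x = m%n<n (toℕ x + n ∸ toℕ j) n

  walk-cdist : (j x : Fin n) → walk j (cdist j x) ≡ x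
  walk-cdist j x = toℕ-injective (begin
    toℕ (walk j (cdist j x))                    ≡⟨ toℕ-walk j (cdist j x) ⟩
    (toℕ j + cdist j x) % n                     ≡⟨ cong (λ d → (toℕ j + d) % n) (cdist-unfold j x) ⟩
    (toℕ j + (toℕ x + (n ∸ toℕ j)) % n) % n     ≡⟨ [a+b%n]%n (toℕ j) _ ⟩
    (toℕ j + (toℕ x + (n ∸ toℕ j))) % n         ≡⟨ cong (_% n) (shuffle (toℕ j) (toℕ x) (<⇒≤ (toℕ<n j))) ⟩
    (toℕ x + n) % n                             ≡⟨ [i+n]%n≡i x ⟩
    toℕ x                                       ∎)
    where
    open ≡-Reasoning
    shuffle : ∀ a b → a ≤ n → a + (b + (n ∸ a)) ≡ b + n
    shuffle a b a≤n = begin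
      a + (b + (n ∸ a))  ≡⟨ +-comm a (b + (n ∸ a)) ⟩
      b + (n ∸ a) + a    ≡⟨ +-assoc b (n ∸ a) a ⟩
      b + (n ∸ a + a)    ≡⟨ cong (b +_) (m∸n+n≡m a≤n) ⟩
      b + n              ∎

  cdist-walk : ∀ j t → t < n → cdist j (walk j t) ≡ t
  cdist-walk j t t<n = begin
    cdist j (walk j t)                          ≡⟨ cdist-unfold j (walk j t) ⟩
    (toℕ (walk j t) + (n ∸ toℕ j)) % n          ≡⟨ cong (λ x → (x + (n ∸ toℕ j)) % n) (toℕ-walk j t) ⟩
    ((toℕ j + t) % n + (n ∸ toℕ j)) % n         ≡⟨ [a%n+b]%n (toℕ j + t) _ ⟩
    (toℕ j + t + (n ∸ toℕ j)) % n               ≡⟨ cong (_% n) (shuffle (toℕ j) t (<⇒≤ (toℕ<n j))) ⟩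
    (t + n) % n                                 ≡⟨ [m+n]%n≡m%n t n ⟩
    t % n                                       ≡⟨ m<n⇒m%n≡m t<n ⟩
    t                                           ∎
    where
    open ≡-Reasoning
    shuffle : ∀ a b → a ≤ n → a + b + (n ∸ a) ≡ b + n
    shuffle a b a≤n = begin
      a + b + (n ∸ a)    ≡⟨ cong (_+ (n ∸ a)) (+-comm a b) ⟩
      b + a + (n ∸ a)    ≡⟨ +-assoc b a (n ∸ a) ⟩
      b + (a + (n ∸ a))  ≡⟨ cong (b +_) (m+[n∸m]≡n a≤n) ⟩
      b + n              ∎

  cdist-injective : (j : Fin n) {x y : Fin n} → cdist j x ≡ cdist j y → x ≡ y
  cdist-injective j {x} {y} eq = trans (sym (walk-cdist j x)) (trans (cong (walk j) eq) (walk-cdist j y))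

  cdist-self : (j : Fin n) → cdist j j ≡ 0
  cdist-self j = cdist-walk j 0 z<s

  cdist≡0⇒≡ : {j x : Fin n} → cdist j x ≡ 0 → x ≡ j
  cdist≡0⇒≡ {j} eq = cdist-injective j (trans eq (sym (cdist-self j)))

  cdist>0 : {j x : Fin n} → x ≢ j → 0 < cdist j x
  cdist>0 x≢j = n≢0⇒n>0 (λ eq → x≢j (cdist≡0⇒≡ eq))

  cdist-prev : (j : Fin n) {x : Fin n} → x ≢ j → suc (cdist j (prev x)) ≡ cdist j x
  cdist-prev j {x} x≢j with cdist j x in eq
  ... | zero  = ⊥-elim (x≢j (cdist≡0⇒≡ eq))
  ... | suc t = cong suc (begin
    cdist j (prev x)                  ≡⟨ cong (cdist j ∘ prev) (walk-cdist j x) ⟨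
    cdist j (prev (walk j (cdist j x))) ≡⟨ cong (λ d → cdist j (prev (walk j d))) eq ⟩
    cdist j (prev (next (walk j t)))  ≡⟨ cong (cdist j) (prev-next (walk j t)) ⟩
    cdist j (walk j t)                ≡⟨ cdist-walk j t (<-trans (n<1+n t) (subst (_< n) eq (cdist<n j x))) ⟩
    t                                 ∎)
    where open ≡-Reasoning

  cdist-prev-self : (j : Fin n) → cdist j (prev j) ≡ m
  cdist-prev-self j = begin
    cdist j (prev j)                ≡⟨ cong (cdist j ∘ prev) walk-n ⟨
    cdist j (prev (next (walk j m))) ≡⟨ cong (cdist j) (prev-next (walk j m)) ⟩
    cdist j (walk j m)              ≡⟨ cdist-walk j m ≤-refl ⟩
    m                               ∎
    where
    open ≡-Reasoning
    walk-n : walk j n ≡ j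
    walk-n = toℕ-injective (trans (toℕ-walk j n) ([i+n]%n≡i j))

  -- Both cases of InOpen describe (j , i) as the clockwise interval (j , prev i].
  InOpen⇒cdist : {j i x : Fin n} → InOpen j i x → 0 < cdist j x × cdist j x ≤ cdist j (prev i)
  InOpen⇒cdist {j} {x = x} (inj₁ (refl , x≢j)) =
    cdist>0 x≢j , subst (cdist j x ≤_) (sym (cdist-prev-self j)) (≤-pred (cdist<n j x))
  InOpen⇒cdist {j} {i} {x} (inj₂ (j≢i , pos , lt)) =
    pos , ≤-pred (subst (cdist j x <_) (sym (cdist-prev j (j≢i ∘ sym))) lt)

  cdist⇒InOpen : {j i x : Fin n} → 0 < cdist j x → cdist j x ≤ cdist j (prev i) → InOpen j i x
  cdist⇒InOpen {j} {i} {x} pos le with j ≟ᶠ i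
  ... | yes refl = inj₁ (refl , λ { refl → <-irrefl (sym (cdist-self j)) pos })
  ... | no j≢i   = inj₂ (j≢i , pos , subst (cdist j x <_) (cdist-prev j (j≢i ∘ sym)) (s≤s le))

  private
    InOpen⇒≢ : {j i x : Fin n} → InOpen j i x → x ≢ j
    InOpen⇒≢ {j} x∈ refl = <-irrefl (sym (cdist-self j)) (proj₁ (InOpen⇒cdist x∈))

  InOpen-prev : {j i x : Fin n} → x ≡ i ⊎ InOpen j i x → prev x ≡ j ⊎ InOpen j i (prev x)
  InOpen-prev {j} {i} {x} x∈ with prev x ≟ᶠ j
  ... | yes px≡j = inj₁ px≡j
  ... | no px≢j  = inj₂ (cdist⇒InOpen (cdist>0 px≢j) (bound x∈))
    where
    bound : x ≡ i ⊎ InOpen j i x → cdist j (prev x) ≤ cdist j (prev i)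
    bound (inj₁ refl) = ≤-refl
    bound (inj₂ x∈ji) = ≤-trans (≤-trans (n≤1+n _) (≤-reflexive (cdist-prev j (InOpen⇒≢ x∈ji))))
                                (proj₂ (InOpen⇒cdist x∈ji))

  InOpen-init : {j i x : Fin n} → prev i ≢ j → InOpen j i x → x ≡ prev i ⊎ InOpen j (prev i) x
  InOpen-init {j} {i} {x} pi≢j x∈ with InOpen⇒cdist x∈
  ... | pos , le with m≤n⇒m<n∨m≡n le
  ...   | inj₂ eq = inj₁ (cdist-injective j eq)
  ...   | inj₁ lt = inj₂ (cdist⇒InOpen pos (≤-pred (subst (cdist j x <_) (sym (cdist-prev j pi≢j)) lt)))

  InOpen-extend : {j i x : Fin n} → prev i ≢ j → InOpen j (prev i) x → InOpen j i x
  InOpen-extend {j} {i} pi≢j x∈ with InOpen⇒cdist x∈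
  ... | pos , le = cdist⇒InOpen pos (≤-trans le (≤-trans (n≤1+n _) (≤-reflexive (cdist-prev j pi≢j))))

  InOpen-empty : {j i x : Fin n} → prev i ≡ j → ¬ InOpen j i x
  InOpen-empty {j} refl x∈ with InOpen⇒cdist x∈
  ... | pos , le = <-irrefl refl (≤-trans pos (≤-trans le (≤-reflexive (cdist-self j))))

  InOpen-trichotomy : {j x y : Fin n} → x ≢ j → x ≢ y → InOpen j y x ⊎ InOpen j x y
  InOpen-trichotomy {j} {x} {y} x≢j x≢y with ≤-<-connex (cdist j x) (cdist j (prev y))
  ... | inj₁ le = inj₁ (cdist⇒InOpen (cdist>0 x≢j) le)
  ... | inj₂ gt with y ≟ᶠ j
  ...   | yes refl = ⊥-elim (<⇒≱ gt (subst (cdist j x ≤_) (sym (cdist-prev-self j)) (≤-pred (cdist<n j x))))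
  ...   | no y≢j = inj₂ (cdist⇒InOpen (cdist>0 y≢j) (≤-pred (subst (cdist j y <_) (sym (cdist-prev j x≢j)) y<x)))
    where
    y<x : cdist j y < cdist j x
    y<x = ≤∧≢⇒< (subst (_≤ cdist j x) (cdist-prev j y≢j) gt) (λ eq → x≢y (sym (cdist-injective j eq)))

  cyclic-induction : ∀ {ℓ} (P : Pred (Fin n) ℓ) (j : Fin n) →
                     P j → (∀ x → x ≢ j → P (prev x) → P x) → ∀ x → P x
  cyclic-induction P j Pj step x = go (cdist j x) x refl
    where
    go : ∀ t x → cdist j x ≡ t → P x
    go zero    x d≡0 = subst P (sym (cdist≡0⇒≡ d≡0)) Pj
    go (suc t) x d≡  = step x x≢j (go t (prev x) (suc-injective (trans (cdist-prev j x≢j) d≡)))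
      where
      x≢j : x ≢ j
      x≢j refl = 0≢1+n (trans (sym (cdist-self j)) d≡)

  interval-induction : ∀ {ℓ} (P : Pred (Fin n) ℓ) {j i : Fin n} →
                       P j → (∀ x → InOpen j i x → P (prev x) → P x) →
                       ∀ x → x ≡ j ⊎ InOpen j i x → P x
  interval-induction P {j} {i} Pj step = cyclic-induction (λ x → x ≡ j ⊎ InOpen j i x → P x) j
    (λ _ → Pj)
    (λ { x x≢j IH (inj₁ x≡j) → ⊥-elim (x≢j x≡j)
       ; x x≢j IH (inj₂ x∈) → step x x∈ (IH (InOpen-prev (inj₂ x∈))) })

  first-after : ∀ {ℓ} {Q : Pred (Fin n) ℓ} → Decidable Q → (j : Fin n) {y : Fin n} → Q y →
                ∃[ i ] Q i × (∀ x → InOpen j i x → ¬ Q x)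
  first-after {Q = Q} Q? j {y} Qy = conclude (scan m (n<1+n m))
    where
    Found = ∃[ i ] Q i × (∀ x → InOpen j i x → ¬ Q x)
    None : ℕ → Set _
    None t = ∀ x → 0 < cdist j x → cdist j x ≤ t → ¬ Q x

    scan : ∀ t → t < n → Found ⊎ None t
    scan zero    _ = inj₂ (λ x pos le _ → <⇒≱ pos le)
    scan (suc t) st<n with scan t (<-trans (n<1+n t) st<n)
    ... | inj₁ found = inj₁ found
    ... | inj₂ none with Q? (walk j (suc t))
    ...   | yes Qw = inj₁ (walk j (suc t) , Qw , λ x x∈ → none x (proj₁ (InOpen⇒cdist x∈))
                                                 (subst (cdist j x ≤_) dist-prev (proj₂ (InOpen⇒cdist x∈))))
      where
      dist-prev : cdist j (prev (walk j (suc t))) ≡ t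
      dist-prev = trans (cong (cdist j) (prev-next (walk j t))) (cdist-walk j t (<-trans (n<1+n t) st<n))
    ...   | no ¬Qw = inj₂ none′
      where
      none′ : None (suc t)
      none′ x pos le with m≤n⇒m<n∨m≡n le
      ... | inj₁ lt = none x pos (≤-pred lt)
      ... | inj₂ eq = subst (λ z → ¬ Q z) (sym (cdist-injective j (trans eq (sym (cdist-walk j (suc t) st<n))))) ¬Qw

    conclude : Found ⊎ None m → Found
    conclude (inj₁ found) = found
    conclude (inj₂ none) with Q? j | y ≟ᶠ j
    ... | yes Qj | _        = j , Qj , λ x x∈ → none x (proj₁ (InOpen⇒cdist x∈)) (≤-pred (cdist<n j x))
    ... | no ¬Qj | yes refl = ⊥-elim (¬Qj Qy)
    ... | no _   | no y≢j   = ⊥-elim (none y (cdist>0 y≢j) (≤-pred (cdist<n j y)) Qy)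

module _ {m : ℕ} where

  prev≢ : (i : Fin (suc (suc m))) → prev i ≢ i
  prev≢ i eq = 1+n≢0 (trans (sym (cdist-prev-self i)) (trans (cong (cdist i) eq) (cdist-self i)))

  next≢ : (i : Fin (suc (suc m))) → next i ≢ i
  next≢ i eq = prev≢ i (trans (cong prev (sym eq)) (prev-next i))

module _ {m : ℕ} where

  prev≢next : (i : Fin (3 + m)) → prev i ≢ next i
  prev≢next i eq = 1+n≢0 (suc-injective
    (trans (sym (cdist-prev-self i)) (trans (cong (cdist i) eq) (cdist-walk i 1 (s≤s (s≤s z≤n))))))

  prev²≢ : (i : Fin (3 + m)) → prev (prev i) ≢ i
  prev²≢ i eq = prev≢next i (trans (sym (next-prev (prev i))) (cong next eq))

-- Vectors and sums

vec-ext : ∀ {A : Set} {n} {u v : Vec A n} → (∀ i → lookup u i ≡ lookup v i) → u ≡ v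
vec-ext {u = u} {v} h = trans (sym (tabulate∘lookup u)) (trans (tabulate-cong h) (tabulate∘lookup v))

sum-tabulate : ∀ {n} (f : Fin n → ℕ) → sum (tabulate f) ≡ ∑ f
sum-tabulate {zero}  f = refl
sum-tabulate {suc n} f = cong (f zero +_) (sum-tabulate (f ∘ suc))

∣p∣≡∑ind : ∀ {n} (p : Subset n) → ∣ p ∣ ≡ ∑ (ind ∘ lookup p)
∣p∣≡∑ind []          = refl
∣p∣≡∑ind (true ∷ p)  = cong suc (∣p∣≡∑ind p)
∣p∣≡∑ind (false ∷ p) = ∣p∣≡∑ind p

sum-[]≔ : ∀ {n} (v : Vec ℕ n) i a → sum (v [ i ]≔ a) + lookup v i ≡ sum v + a
sum-[]≔ (x ∷ v) zero    a = xy∙z≈zy∙x a (sum v) x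
sum-[]≔ (x ∷ v) (suc i) a = begin
  x + sum (v [ i ]≔ a) + lookup v i    ≡⟨ +-assoc x _ _ ⟩
  x + (sum (v [ i ]≔ a) + lookup v i)  ≡⟨ cong (x +_) (sum-[]≔ v i a) ⟩
  x + (sum v + a)                      ≡⟨ +-assoc x (sum v) a ⟨
  x + sum v + a                        ∎
  where open ≡-Reasoning

sum-[]≔-< : ∀ {n} (v : Vec ℕ n) {i a} → lookup v i < a → sum v < sum (v [ i ]≔ a)
sum-[]≔-< v {i} {a} lt = +-cancelʳ-< (lookup v i) (sum v) (sum (v [ i ]≔ a)) (begin-strict
  sum v + lookup v i        <⟨ +-monoʳ-< (sum v) lt ⟩
  sum v + a                 ≡⟨ sum-[]≔ v i a ⟨
  sum (v [ i ]≔ a) + lookup v i ∎)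
  where open ≤-Reasoning

sum≤ : ∀ {n b} (v : Vec ℕ n) → (∀ i → lookup v i ≤ b) → sum v ≤ n * b
sum≤ []      _ = z≤n
sum≤ (x ∷ v) h = +-mono-≤ (h zero) (sum≤ v (h ∘ suc))

∑-prev : ∀ {m} (f : Fin (suc m) → ℕ) → ∑ (f ∘ prev) ≡ ∑ f
∑-prev f = sym (∑-permute f (permutation prev next prev-next next-prev))

∑-const-1 : ∀ n → ∑ {n} (λ _ → 1) ≡ n
∑-const-1 zero    = refl
∑-const-1 (suc n) = cong suc (∑-const-1 n)

-- Orientations of C_n

true≢false : true ≢ false
true≢false ()

does≡true⇒ : ∀ {A : Set} (a? : Dec A) → does a? ≡ true → A
does≡true⇒ (yes a) _ = a

ind≤1 : ∀ p → ind p ≤ 1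
ind≤1 true  = s≤s z≤n
ind≤1 false = z≤n

ind≤0⇒false : ∀ {p} → ind p ≤ 0 → p ≡ false
ind≤0⇒false {false} _ = refl
ind≤0⇒false {true}  ()

ind-injective : ∀ {p q} → ind p ≡ ind q → p ≡ q
ind-injective {true}  {true}  _ = refl
ind-injective {false} {false} _ = refl

ind-∨ : ∀ p a → ind (p ∨ a) ≤ ind p + ind a
ind-∨ true  a = s≤s z≤n
ind-∨ false a = ≤-refl

ind-∧-not : ∀ p b → ind (p ∧ not b) + ind b ≤ 1
ind-∧-not true  true  = ≤-refl
ind-∧-not true  false = ≤-refl
ind-∧-not false b     = ind≤1 b

ind¬ : Bool → ℕ
ind¬ q = if q then 0 else 1

ind¬-∨ : ∀ q a → ind¬ (q ∨ a) + ind a ≤ 1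
ind¬-∨ true  a     = ind≤1 a
ind¬-∨ false true  = ≤-refl
ind¬-∨ false false = ≤-refl

ind¬-∧-not : ∀ p b → ind¬ (p ∧ not b) ≤ ind¬ p + ind b
ind¬-∧-not true  true  = ≤-refl
ind¬-∧-not true  false = z≤n
ind¬-∧-not false b     = m≤m+n 1 (ind b)

indeg≡ : ∀ {n} (o : Orientation n) x {p q} → lookup o x ≡ p → lookup o (prev x) ≡ q →
         indeg o x ≡ ind p + ind¬ q
indeg≡ o x = cong₂ (λ p q → ind p + ind¬ q)

indeg≤2 : ∀ {n} (o : Orientation n) x → indeg o x ≤ 2
indeg≤2 o x = +-mono-≤ (ind≤1 (lookup o x)) (ind¬≤1 (lookup o (prev x)))
  where
  ind¬≤1 : ∀ p → ind¬ p ≤ 1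
  ind¬≤1 true  = z≤n
  ind¬≤1 false = s≤s z≤n

indeg-after-clockwise : ∀ {n} (o : Orientation n) x → lookup o (prev x) ≡ false →
                        indeg o x ≡ ind (lookup o x) + 1
indeg-after-clockwise o x eq = cong (λ q → ind (lookup o x) + ind¬ q) eq

indeg≤0⇒ : ∀ {n} (o : Orientation n) x → indeg o x ≤ 0 → lookup o x ≡ false × lookup o (prev x) ≡ true
indeg≤0⇒ o x le with lookup o x | lookup o (prev x)
... | false | true  = refl , refl
... | true  | _     = ⊥-elim (<⇒≱ z<s le)
... | false | false = ⊥-elim (<⇒≱ z<s le)

∑-indeg : ∀ {m} (o : Orientation (suc m)) → ∑ (indeg o) ≡ suc m
∑-indeg {m} o = begin
  ∑ (λ q → ind (lookup o q) + ind¬ (lookup o (prev q)))  ≡⟨ ∑-distrib-+ (ind ∘ lookup o) (ind¬ ∘ lookup o ∘ prev) ⟩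
  ∑ (ind ∘ lookup o) + ∑ (ind¬ ∘ lookup o ∘ prev)        ≡⟨ cong (∑ (ind ∘ lookup o) +_) (∑-prev (ind¬ ∘ lookup o)) ⟩
  ∑ (ind ∘ lookup o) + ∑ (ind¬ ∘ lookup o)               ≡⟨ ∑-distrib-+ (ind ∘ lookup o) (ind¬ ∘ lookup o) ⟨
  ∑ (λ q → ind (lookup o q) + ind¬ (lookup o q))         ≡⟨ sum-cong-≗ (λ q → ind+ind¬ (lookup o q)) ⟩
  ∑ {suc m} (λ _ → 1)                                    ≡⟨ ∑-const-1 (suc m) ⟩
  suc m                                                  ∎
  where
  open ≡-Reasoning
  ind+ind¬ : ∀ p → ind p + ind¬ p ≡ 1
  ind+ind¬ true  = refl
  ind+ind¬ false = refl

HasIndegrees⇒indeg≡ : ∀ {n} {c′ : Config n} (o : Orientation n) → HasIndegrees c′ o →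
                      ∀ q → indeg o q ≡ lookup c′ q
HasIndegrees⇒indeg≡ o has q = trans (sym (lookup∘tabulate (indeg o) q)) (cong (λ v → lookup v q) has)

indeg-determines : ∀ {m} (o o′ : Orientation (suc m)) j → (∀ q → indeg o q ≡ indeg o′ q) →
                   lookup o j ≡ lookup o′ j → o ≡ o′
indeg-determines o o′ j same oj≡o′j =
  vec-ext (cyclic-induction (λ x → lookup o x ≡ lookup o′ x) j oj≡o′j step)
  where
  step : ∀ x → x ≢ j → lookup o (prev x) ≡ lookup o′ (prev x) → lookup o x ≡ lookup o′ x
  step x _ eq = ind-injective (+-cancelʳ-≡ (ind¬ (lookup o (prev x))) _ _
    (trans (same x) (cong (λ q → ind (lookup o′ x) + ind¬ q) (sym eq))))

∈-allOrientations : ∀ {n} (o : Orientation n) → o ∈ˡ allOrientations n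
∈-allOrientations []          = here refl
∈-allOrientations (true ∷ o)  = ∈-++⁺ˡ (∈-map⁺ (true ∷_) (∈-allOrientations o))
∈-allOrientations (false ∷ o) = ∈-++⁺ʳ _ (∈-map⁺ (false ∷_) (∈-allOrientations o))

hasIndegrees? : ∀ {n} (c′ : Config n) (o : Orientation n) → Dec (HasIndegrees c′ o)
hasIndegrees? c′ o = ≡-dec _≟ℕ_ (tabulate (indeg o)) c′

𝒪-ones : ∀ {n} → 𝒪 (replicate n 1) ≡ replicate n true
𝒪-ones {n} with ≡-dec _≟ℕ_ (replicate n 1) (replicate n 1)
... | yes _    = refl
... | no ≢ones = ⊥-elim (≢ones refl)

𝒪-unique : ∀ {n} (c′ : Config n) {o₀ : Orientation n} → c′ ≢ replicate n 1 → HasIndegrees c′ o₀ →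
           (∀ o → HasIndegrees c′ o → o ≡ o₀) → 𝒪 c′ ≡ o₀
𝒪-unique {n} c′ {o₀} ≢ones has-o₀ unique with ≡-dec _≟ℕ_ c′ (replicate n 1)
... | yes ≡ones = ⊥-elim (≢ones ≡ones)
... | no _ with filter (hasIndegrees? c′) (allOrientations n) in eq
...   | o List.∷ _ = unique o (proj₂ (∈-filter⁻ (hasIndegrees? c′) {xs = allOrientations n}
                                        (subst (o ∈ˡ_) (sym eq) (here refl))))
...   | List.[] with subst (o₀ ∈ˡ_) eq (∈-filter⁺ (hasIndegrees? c′) (∈-allOrientations o₀) has-o₀)
...     | ()

-- Configurations dominating an orientation

stable-cases : ∀ {x} → x < 3 → x ≡ 0 ⊎ x ≡ 1 ⊎ x ≡ 2
stable-cases {0} _ = inj₁ refl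
stable-cases {1} _ = inj₂ (inj₁ refl)
stable-cases {2} _ = inj₂ (inj₂ refl)
stable-cases {suc (suc (suc _))} (s≤s (s≤s (s≤s ())))

addGrain-self : ∀ {n} (c : Config n) i → lookup (addGrain c i) i ≡ lookup c i + 1
addGrain-self c i rewrite lookup∘tabulate (λ x → lookup c x + (if does (x ≟ᶠ i) then 1 else 0)) i
                        | dec-true (i ≟ᶠ i) refl = refl

addGrain-other : ∀ {n} (c : Config n) i {x} → x ≢ i → lookup (addGrain c i) x ≡ lookup c x
addGrain-other c i {x} x≢i rewrite lookup∘tabulate (λ x → lookup c x + (if does (x ≟ᶠ i) then 1 else 0)) x
                                 | dec-false (x ≟ᶠ i) x≢i = +-identityʳ _

addGrain≡[]≔ : ∀ {n} (c : Config n) i → addGrain c i ≡ c [ i ]≔ (lookup c i + 1)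
addGrain≡[]≔ c i = vec-ext at
  where
  at : ∀ x → lookup (addGrain c i) x ≡ lookup (c [ i ]≔ (lookup c i + 1)) x
  at x with x ≟ᶠ i
  ... | yes refl = trans (addGrain-self c x) (sym (lookup∘update x c _))
  ... | no x≢i   = trans (addGrain-other c i x≢i) (sym (lookup∘update′ x≢i c _))

addGrain-≥ : ∀ {n} (c : Config n) i x → lookup c x ≤ lookup (addGrain c i) x
addGrain-≥ c i x with x ≟ᶠ i
... | yes refl = ≤-trans (m≤m+n (lookup c x) 1) (≤-reflexive (sym (addGrain-self c x)))
... | no x≢i   = ≤-reflexive (sym (addGrain-other c i x≢i))

addGrain-stable : ∀ {n} (c : Config n) i → Stable c → lookup c i ≤ 1 → Stable (addGrain c i)
addGrain-stable c i Sc ci≤1 x with x ≟ᶠ i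
... | yes refl = subst (_< 3) (sym (addGrain-self c x)) (s≤s (+-monoˡ-≤ 1 ci≤1))
... | no x≢i   = subst (_< 3) (sym (addGrain-other c i x≢i)) (Sc x)

stable-reach : ∀ {n} {c d : Config n} → Reach c d → Stable c → Stable d
stable-reach ε                     Sc = Sc
stable-reach ((_ , _ , _ , Sd) ◅ r) _  = stable-reach r Sd

stable-induction : ∀ {n ℓ} (P : Config n → Set ℓ) →
                   (∀ c → Stable c → (∀ d → Stable d → sum c < sum d → P d) → P c) →
                   ∀ c → Stable c → P c
stable-induction {n} P step c = <-rec (λ r → ∀ c → n * 2 ∸ sum c ≡ r → Stable c → P c)
  (λ r IH c gap Sc → step c Sc λ d Sd lt →
    IH (subst (n * 2 ∸ sum d <_) gap (∸-monoʳ-< lt (sum≤ d (≤-pred ∘ Sd)))) d refl Sd)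
  _ c refl

DominatesOrientation : ∀ {n} → Config n → Set
DominatesOrientation {n} c = Σ (Orientation n) λ o → ∀ x → indeg o x ≤ lookup c x

dominates-mono : ∀ {n} (c d : Config n) → (∀ x → lookup c x ≤ lookup d x) →
                 DominatesOrientation c → DominatesOrientation d
dominates-mono _ _ c≤d (o , o≤c) = o , λ x → ≤-trans (o≤c x) (c≤d x)

OnesBetween : ∀ {n} → Config n → Fin n → Fin n → Set
OnesBetween c j i = ∀ x → InOpen j i x → lookup c x ≡ 1

ZerosFollowedByTwos : ∀ {n} → Config n → Set
ZerosFollowedByTwos {n} c = ∀ j → lookup c j ≡ 0 → ∃[ i ] lookup c i ≡ 2 × OnesBetween c j i

dominates⇒zerosFollowedByTwos : ∀ {m} (c : Config (suc m)) → Stable c → DominatesOrientation c → ZerosFollowedByTwos c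
dominates⇒zerosFollowedByTwos c Sc (o , o≤c) j cj≡0
  with first-after (λ x → ¬? (lookup c x ≟ℕ 1)) j {j} (λ cj≡1 → 0≢1+n (trans (sym cj≡0) cj≡1))
... | i , ci≢1 , not-not-one = i , ci≡2 , ones
  where
  ones : OnesBetween c j i
  ones x x∈ = decidable-stable (lookup c x ≟ℕ 1) (not-not-one x x∈)

  clockwise : ∀ x → x ≡ j ⊎ InOpen j i x → lookup o x ≡ false
  clockwise = interval-induction (λ x → lookup o x ≡ false) oj≡false step
    where
    oj≡false : lookup o j ≡ false
    oj≡false = proj₁ (indeg≤0⇒ o j (subst (indeg o j ≤_) cj≡0 (o≤c j)))
    step : ∀ x → InOpen j i x → lookup o (prev x) ≡ false → lookup o x ≡ false
    step x x∈ opx≡false = ind≤0⇒false (+-cancelʳ-≤ 1 _ 0 (begin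
      ind (lookup o x) + 1  ≡⟨ indeg-after-clockwise o x opx≡false ⟨
      indeg o x             ≤⟨ o≤c x ⟩
      lookup c x            ≡⟨ ones x x∈ ⟩
      1                     ∎))
      where open ≤-Reasoning

  ci≢0 : lookup c i ≢ 0
  ci≢0 ci≡0 = <⇒≱ z<s (m+n≤o⇒n≤o (ind (lookup o i)) (begin
    ind (lookup o i) + 1  ≡⟨ indeg-after-clockwise o i (clockwise (prev i) (InOpen-prev (inj₁ refl))) ⟨
    indeg o i             ≤⟨ o≤c i ⟩
    lookup c i            ≡⟨ ci≡0 ⟩
    0                     ∎))
    where open ≤-Reasoning

  ci≡2 : lookup c i ≡ 2
  ci≡2 with stable-cases (Sc i)
  ... | inj₁ ci≡0        = ⊥-elim (ci≢0 ci≡0)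
  ... | inj₂ (inj₁ ci≡1) = ⊥-elim (ci≢1 ci≡1)
  ... | inj₂ (inj₂ ci≡2) = ci≡2

two-before-non-two : ∀ {m} (c : Config (suc m)) {i y} → lookup c i ≡ 2 → lookup c y ≢ 2 →
                     ∃[ w ] lookup c w ≢ 2 × lookup c (prev w) ≡ 2
two-before-non-two c {i} ci≡2 cy≢2 with first-after (λ x → ¬? (lookup c x ≟ℕ 2)) i cy≢2
... | w , cw≢2 , not-not-two = w , cw≢2 , cpw≡2 (InOpen-prev {j = i} {i = w} (inj₁ refl))
  where
  cpw≡2 : prev w ≡ i ⊎ InOpen i w (prev w) → lookup c (prev w) ≡ 2
  cpw≡2 (inj₁ pw≡i) = trans (cong (lookup c) pw≡i) ci≡2
  cpw≡2 (inj₂ pw∈)  = decidable-stable (lookup c (prev w) ≟ℕ 2) (not-not-two (prev w) pw∈)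

-- Recurrence on the wheel

module _ {k : ℕ} where

  private
    n : ℕ
    n = 3 + k

  lookup-topple : ∀ (c : Config n) i a b s x → lookup (topple c i a b s) x ≡
    lookup c x + (if does (x ≟ᶠ prev i) then ind a else 0) + (if does (x ≟ᶠ next i) then ind b else 0)
      ∸ (if does (x ≟ᶠ i) then ind a + ind b + ind s else 0)
  lookup-topple c i a b s x = lookup∘tabulate (λ x → lookup c x + (if does (x ≟ᶠ prev i) then ind a else 0)
    + (if does (x ≟ᶠ next i) then ind b else 0) ∸ (if does (x ≟ᶠ i) then ind a + ind b + ind s else 0)) x

  topple-self : ∀ (c : Config n) i a b s → lookup (topple c i a b s) i ≡ lookup c i ∸ (ind a + ind b + ind s)
  topple-self c i a b s
    rewrite lookup-topple c i a b s i | dec-false (i ≟ᶠ prev i) (prev≢ i ∘ sym)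
          | dec-false (i ≟ᶠ next i) (next≢ i ∘ sym) | dec-true (i ≟ᶠ i) refl
    = cong (_∸ (ind a + ind b + ind s)) (trans (+-identityʳ _) (+-identityʳ _))

  topple-prev : ∀ (c : Config n) i a b s → lookup (topple c i a b s) (prev i) ≡ lookup c (prev i) + ind a
  topple-prev c i a b s
    rewrite lookup-topple c i a b s (prev i) | dec-true (prev i ≟ᶠ prev i) refl
          | dec-false (prev i ≟ᶠ next i) (prev≢next i) | dec-false (prev i ≟ᶠ i) (prev≢ i)
    = +-identityʳ _

  topple-next : ∀ (c : Config n) i a b s → lookup (topple c i a b s) (next i) ≡ lookup c (next i) + ind b
  topple-next c i a b s
    rewrite lookup-topple c i a b s (next i) | dec-false (next i ≟ᶠ prev i) (prev≢next i ∘ sym)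
          | dec-true (next i ≟ᶠ next i) refl | dec-false (next i ≟ᶠ i) (next≢ i)
    = cong (_+ ind b) (+-identityʳ _)

  topple-other : ∀ (c : Config n) i a b s {x} → x ≢ i → x ≢ prev i → x ≢ next i →
                 lookup (topple c i a b s) x ≡ lookup c x
  topple-other c i a b s {x} x≢i x≢pi x≢ni
    rewrite lookup-topple c i a b s x | dec-false (x ≟ᶠ prev i) x≢pi
          | dec-false (x ≟ᶠ next i) x≢ni | dec-false (x ≟ᶠ i) x≢i
    = trans (+-identityʳ _) (+-identityʳ _)

  topple-sink-other : ∀ (c : Config n) i s {x} → x ≢ i → lookup (topple c i false false s) x ≡ lookup c x
  topple-sink-other c i s {x} x≢i with x ≟ᶠ prev i | x ≟ᶠ next i
  ... | yes refl | _        = trans (topple-prev c i false false s) (+-identityʳ _)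
  ... | no _     | yes refl = trans (topple-next c i false false s) (+-identityʳ _)
  ... | no x≢pi  | no x≢ni  = topple-other c i false false s x≢i x≢pi x≢ni

  topple-backward-other : ∀ (c : Config n) i a s {x} → x ≢ i → x ≢ prev i →
                          lookup (topple c i a false s) x ≡ lookup c x
  topple-backward-other c i a s {x} x≢i x≢pi with x ≟ᶠ next i
  ... | yes refl = trans (topple-next c i a false s) (+-identityʳ _)
  ... | no x≢ni  = topple-other c i a false s x≢i x≢pi x≢ni

  topple-forward-other : ∀ (c : Config n) i b s {x} → x ≢ i → x ≢ next i →
                         lookup (topple c i false b s) x ≡ lookup c x
  topple-forward-other c i b s {x} x≢i x≢ni with x ≟ᶠ prev i
  ... | yes refl = trans (topple-prev c i false b s) (+-identityʳ _)
  ... | no x≢pi  = topple-other c i false b s x≢i x≢pi x≢ni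

  -- Reversing the edges along which grains are sent keeps every in-degree below the grain count.
  module Reorient (c : Config n) (i : Fin n) (a b s : Bool) (o : Orientation n)
                  (o≤c : ∀ x → indeg o x ≤ lookup c x) where

    o₁ o′ : Orientation n
    o₁ = o [ prev i ]≔ (lookup o (prev i) ∨ a)
    o′ = o₁ [ i ]≔ (lookup o i ∧ not b)

    o′-self : lookup o′ i ≡ lookup o i ∧ not b
    o′-self = lookup∘update i o₁ _

    o′-prev : lookup o′ (prev i) ≡ lookup o (prev i) ∨ a
    o′-prev = trans (lookup∘update′ (prev≢ i) o₁ _) (lookup∘update (prev i) o _)

    o′-other : ∀ {x} → x ≢ i → x ≢ prev i → lookup o′ x ≡ lookup o x
    o′-other x≢i x≢pi = trans (lookup∘update′ x≢i o₁ _) (lookup∘update′ x≢pi o _)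

    open ≤-Reasoning

    at-self : 3 ≤ lookup c i → indeg o′ i ≤ lookup (topple c i a b s) i
    at-self 3≤ci = begin
      indeg o′ i                                 ≡⟨ indeg≡ o′ i o′-self o′-prev ⟩
      ind (p ∧ not b) + ind¬ (q ∨ a) ≤⟨ m+n≤o⇒m≤o∸n _ (≤-trans budget 3≤ci) ⟩
      lookup c i ∸ (ind a + ind b + ind s)       ≡⟨ topple-self c i a b s ⟨
      lookup (topple c i a b s) i                ∎
      where
      open +-*-Solver
      p = lookup o i
      q = lookup o (prev i)
      budget : ind (p ∧ not b) + ind¬ (q ∨ a) + (ind a + ind b + ind s) ≤ 3
      budget = begin
        ind (p ∧ not b) + ind¬ (q ∨ a) + (ind a + ind b + ind s)
          ≡⟨ solve 5 (λ x b y a s → (x :+ y) :+ (a :+ b :+ s) := (x :+ b) :+ (y :+ a) :+ s) refl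
                   (ind (p ∧ not b)) (ind b) (ind¬ (q ∨ a)) (ind a) (ind s) ⟩
        ind (p ∧ not b) + ind b + (ind¬ (q ∨ a) + ind a) + ind s
          ≤⟨ +-mono-≤ (+-mono-≤ (ind-∧-not p b) (ind¬-∨ q a)) (ind≤1 s) ⟩
        3 ∎

    at-prev : indeg o′ (prev i) ≤ lookup (topple c i a b s) (prev i)
    at-prev = begin
      indeg o′ (prev i)
        ≡⟨ indeg≡ o′ (prev i) o′-prev (o′-other (prev²≢ i) (prev≢ (prev i))) ⟩
      ind (p ∨ a) + r                             ≤⟨ +-monoˡ-≤ r (ind-∨ p a) ⟩
      ind p + ind a + r                           ≡⟨ xy∙z≈xz∙y (ind p) (ind a) r ⟩
      indeg o (prev i) + ind a                    ≤⟨ +-monoˡ-≤ (ind a) (o≤c (prev i)) ⟩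
      lookup c (prev i) + ind a                   ≡⟨ topple-prev c i a b s ⟨
      lookup (topple c i a b s) (prev i)          ∎
      where
      p = lookup o (prev i)
      r = ind¬ (lookup o (prev (prev i)))

    at-next : indeg o′ (next i) ≤ lookup (topple c i a b s) (next i)
    at-next = begin
      indeg o′ (next i)                           ≡⟨ indeg≡ o′ (next i) (o′-other (next≢ i) (prev≢next i ∘ sym))
                                                                       (trans (cong (lookup o′) (prev-next i)) o′-self) ⟩
      ind p + ind¬ (lookup o i ∧ not b) ≤⟨ +-monoʳ-≤ (ind p) (ind¬-∧-not (lookup o i) b) ⟩
      ind p + (ind¬ (lookup o i) + ind b) ≡⟨ +-assoc (ind p) _ (ind b) ⟨
      ind p + ind¬ (lookup o i) + ind b ≡⟨ cong (λ y → ind p + ind¬ (lookup o y) + ind b) (prev-next i) ⟨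
      indeg o (next i) + ind b                    ≤⟨ +-monoˡ-≤ (ind b) (o≤c (next i)) ⟩
      lookup c (next i) + ind b                   ≡⟨ topple-next c i a b s ⟨
      lookup (topple c i a b s) (next i)          ∎
      where
      p = lookup o (next i)

    at-other : ∀ {x} → x ≢ i → x ≢ prev i → x ≢ next i → indeg o′ x ≤ lookup (topple c i a b s) x
    at-other {x} x≢i x≢pi x≢ni = begin
      indeg o′ x                 ≡⟨ indeg≡ o′ x (o′-other x≢i x≢pi) (o′-other px≢i (x≢i ∘ prev-injective)) ⟩
      indeg o x                  ≤⟨ o≤c x ⟩
      lookup c x                 ≡⟨ topple-other c i a b s x≢i x≢pi x≢ni ⟨
      lookup (topple c i a b s) x ∎
      where
      px≢i : prev x ≢ i
      px≢i eq = x≢ni (trans (sym (next-prev x)) (cong next eq))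

    bound : 3 ≤ lookup c i → ∀ x → indeg o′ x ≤ lookup (topple c i a b s) x
    bound 3≤ci x with x ≟ᶠ i | x ≟ᶠ prev i | x ≟ᶠ next i
    ... | yes refl | _        | _        = at-self 3≤ci
    ... | no _     | yes refl | _        = at-prev
    ... | no _     | no _     | yes refl = at-next
    ... | no x≢i   | no x≢pi  | no x≢ni  = at-other x≢i x≢pi x≢ni

  dominates-topple : ∀ (c : Config n) i a b s → 3 ≤ lookup c i →
                     DominatesOrientation c → DominatesOrientation (topple c i a b s)
  dominates-topple c i a b s 3≤ci (o , o≤c) = o′ , bound 3≤ci
    where open Reorient c i a b s o o≤c

  dominates-stabilise : {c d : Config n} → Star ToppleStep c d →
                        DominatesOrientation c → DominatesOrientation d
  dominates-stabilise ε                                        D = D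
  dominates-stabilise {c} ((i , 3≤ci , a , b , s , refl) ◅ r) D =
    dominates-stabilise r (dominates-topple c i a b s 3≤ci D)

  dominates-reach : {c d : Config n} → Reach c d → DominatesOrientation c → DominatesOrientation d
  dominates-reach ε                          D = D
  dominates-reach {c} ((_ , i , steps , _) ◅ r) D =
    dominates-reach r (dominates-stabilise steps (dominates-mono c (addGrain c i) (addGrain-≥ c i) D))

  maxStable : Config n
  maxStable = replicate n 2

  all-two⇒maxStable : ∀ (c : Config n) → (∀ x → lookup c x ≡ 2) → c ≡ maxStable
  all-two⇒maxStable c all-two = vec-ext λ x → trans (all-two x) (sym (lookup-replicate x 2))

  dominates-maxStable : DominatesOrientation maxStable
  dominates-maxStable = replicate n true , λ x →
    subst (indeg (replicate n true) x ≤_) (sym (lookup-replicate x 2)) (indeg≤2 (replicate n true) x)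

  reach-maxStable : ∀ d → Stable d → Reach d maxStable
  reach-maxStable = stable-induction (λ d → Reach d maxStable) step
    where
    step : ∀ d → Stable d → (∀ e → Stable e → sum d < sum e → Reach e maxStable) → Reach d maxStable
    step d Sd IH with all? (λ x → lookup d x ≟ℕ 2)
    ... | yes all-two = subst (Reach d) (all-two⇒maxStable d all-two) ε
    ... | no ¬all-two with ¬∀⟶∃¬ n _ (λ x → lookup d x ≟ℕ 2) ¬all-two
    ...   | i , di≢2 = (Sd , i , ε , Sd′) ◅ IH (addGrain d i) Sd′ more
      where
      di≤1 : lookup d i ≤ 1
      di≤1 with stable-cases (Sd i)
      ... | inj₁ di≡0        = ≤-trans (≤-reflexive di≡0) z≤n
      ... | inj₂ (inj₁ di≡1) = ≤-reflexive di≡1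
      ... | inj₂ (inj₂ di≡2) = ⊥-elim (di≢2 di≡2)
      Sd′ : Stable (addGrain d i)
      Sd′ = addGrain-stable d i Sd di≤1
      more : sum d < sum (addGrain d i)
      more = subst (λ e → sum d < sum e) (sym (addGrain≡[]≔ d i)) (sum-[]≔-< d (m<m+n (lookup d i) z<s))

  Predecessor : Config n → Set
  Predecessor c = ∃[ x ] Stable x × DominatesOrientation x × sum c < sum x × ChainStep x c

  -- A move raises y to 2 in x; the grain then added at y is passed on by topplings until the
  -- surplus has left through the sink.
  module RaiseToTwo (c : Config n) (Sc : Stable c) (y : Fin n) (cy≤1 : lookup c y ≤ 1) where

    x : Config n
    x = c [ y ]≔ 2

    stable-x : Stable x
    stable-x z with z ≟ᶠ y
    ... | yes refl = subst (_< 3) (sym (lookup∘update z c 2)) ≤-refl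
    ... | no z≢y   = subst (_< 3) (sym (lookup∘update′ z≢y c 2)) (Sc z)

    c≤x : ∀ z → lookup c z ≤ lookup x z
    c≤x z with z ≟ᶠ y
    ... | yes refl = ≤-trans (≤-trans cy≤1 (n≤1+n 1)) (≤-reflexive (sym (lookup∘update z c 2)))
    ... | no z≢y   = ≤-reflexive (sym (lookup∘update′ z≢y c 2))

    x⁺ : Config n
    x⁺ = addGrain x y

    grain-self : lookup x⁺ y ≡ 3
    grain-self = trans (addGrain-self x y) (cong (_+ 1) (lookup∘update y c 2))

    grain-other : ∀ {z} → z ≢ y → lookup x⁺ z ≡ lookup c z
    grain-other z≢y = trans (addGrain-other x y z≢y) (lookup∘update′ z≢y c 2)

    predecessor : DominatesOrientation c → Star ToppleStep x⁺ c → Predecessor c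
    predecessor D steps = x , stable-x , dominates-mono c x c≤x D , sum-[]≔-< c (s≤s cy≤1) ,
                          (stable-x , y , steps , Sc)

  fire-backward : ∀ c → Stable c → DominatesOrientation c → ∀ y →
                  lookup c y ≡ 1 → lookup c (prev y) ≡ 2 → Predecessor c
  fire-backward c Sc D y cy≡1 cpy≡2 = predecessor D
    ((y , ≤-reflexive (sym grain-self) , true , false , true , refl) ◅
     (prev y , ≤-reflexive (sym c₁-prev) , false , false , true , c≡c₂) ◅ ε)
    where
    open RaiseToTwo c Sc y (≤-reflexive cy≡1)
    c₁ = topple x⁺ y true false true
    c₁-prev : lookup c₁ (prev y) ≡ 3
    c₁-prev = trans (topple-prev x⁺ y true false true) (cong (_+ 1) (trans (grain-other (prev≢ y)) cpy≡2))
    c≡c₂ : c ≡ topple c₁ (prev y) false false true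
    c≡c₂ = vec-ext λ z → sym (at z)
      where
      at : ∀ z → lookup (topple c₁ (prev y) false false true) z ≡ lookup c z
      at z with z ≟ᶠ prev y | z ≟ᶠ y
      ... | yes refl | _        = trans (topple-self c₁ z false false true) (trans (cong (_∸ 1) c₁-prev) (sym cpy≡2))
      ... | no z≢py  | yes refl = trans (topple-sink-other c₁ (prev z) true z≢py)
                                        (trans (topple-self x⁺ z true false true) (trans (cong (_∸ 2) grain-self) (sym cy≡1)))
      ... | no z≢py  | no z≢y   = trans (topple-sink-other c₁ (prev y) true z≢py)
                                        (trans (topple-backward-other x⁺ y true true z≢y z≢py) (grain-other z≢y))

  fire-forward : ∀ c → Stable c → DominatesOrientation c → ∀ y →
                 lookup c y ≡ 1 → lookup c (next y) ≡ 2 → Predecessor c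
  fire-forward c Sc D y cy≡1 cny≡2 = predecessor D
    ((y , ≤-reflexive (sym grain-self) , false , true , true , refl) ◅
     (next y , ≤-reflexive (sym c₁-next) , false , false , true , c≡c₂) ◅ ε)
    where
    open RaiseToTwo c Sc y (≤-reflexive cy≡1)
    c₁ = topple x⁺ y false true true
    c₁-next : lookup c₁ (next y) ≡ 3
    c₁-next = trans (topple-next x⁺ y false true true) (cong (_+ 1) (trans (grain-other (next≢ y)) cny≡2))
    c≡c₂ : c ≡ topple c₁ (next y) false false true
    c≡c₂ = vec-ext λ z → sym (at z)
      where
      at : ∀ z → lookup (topple c₁ (next y) false false true) z ≡ lookup c z
      at z with z ≟ᶠ next y | z ≟ᶠ y
      ... | yes refl | _        = trans (topple-self c₁ z false false true) (trans (cong (_∸ 1) c₁-next) (sym cny≡2))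
      ... | no z≢ny  | yes refl = trans (topple-sink-other c₁ (next z) true z≢ny)
                                        (trans (topple-self x⁺ z false true true) (trans (cong (_∸ 2) grain-self) (sym cy≡1)))
      ... | no z≢ny  | no z≢y   = trans (topple-sink-other c₁ (next y) true z≢ny)
                                        (trans (topple-forward-other x⁺ y true true z≢y z≢ny) (grain-other z≢y))

  fire-both : ∀ c → Stable c → DominatesOrientation c → ∀ y →
              lookup c y ≡ 0 → lookup c (prev y) ≡ 2 → lookup c (next y) ≡ 2 → Predecessor c
  fire-both c Sc D y cy≡0 cpy≡2 cny≡2 = predecessor D
    ((y , ≤-reflexive (sym grain-self) , true , true , true , refl) ◅
     (prev y , ≤-reflexive (sym c₁-prev) , false , false , true , refl) ◅
     (next y , ≤-reflexive (sym c₂-next) , false , false , true , c≡c₃) ◅ ε)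
    where
    open RaiseToTwo c Sc y (≤-trans (≤-reflexive cy≡0) z≤n)
    c₁ = topple x⁺ y true true true
    c₂ = topple c₁ (prev y) false false true
    c₁-prev : lookup c₁ (prev y) ≡ 3
    c₁-prev = trans (topple-prev x⁺ y true true true) (cong (_+ 1) (trans (grain-other (prev≢ y)) cpy≡2))
    c₁-next : lookup c₁ (next y) ≡ 3
    c₁-next = trans (topple-next x⁺ y true true true) (cong (_+ 1) (trans (grain-other (next≢ y)) cny≡2))
    c₂-next : lookup c₂ (next y) ≡ 3
    c₂-next = trans (topple-sink-other c₁ (prev y) true (prev≢next y ∘ sym)) c₁-next
    c≡c₃ : c ≡ topple c₂ (next y) false false true
    c≡c₃ = vec-ext λ z → sym (at z)
      where
      at : ∀ z → lookup (topple c₂ (next y) false false true) z ≡ lookup c z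
      at z with z ≟ᶠ next y | z ≟ᶠ prev y | z ≟ᶠ y
      ... | yes refl | _        | _        = trans (topple-self c₂ z false false true) (trans (cong (_∸ 1) c₂-next) (sym cny≡2))
      ... | no z≢ny  | yes refl | _        = trans (topple-sink-other c₂ (next y) true z≢ny)
                                             (trans (topple-self c₁ z false false true) (trans (cong (_∸ 1) c₁-prev) (sym cpy≡2)))
      ... | no z≢ny  | no z≢py  | yes refl = trans (topple-sink-other c₂ (next z) true z≢ny)
                                             (trans (topple-sink-other c₁ (prev z) true z≢py)
                                             (trans (topple-self x⁺ z true true true) (trans (cong (_∸ 3) grain-self) (sym cy≡0))))
      ... | no z≢ny  | no z≢py  | no z≢y   = trans (topple-sink-other c₂ (next y) true z≢ny)
                                             (trans (topple-sink-other c₁ (prev y) true z≢py)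
                                             (trans (topple-other x⁺ y true true true z≢y z≢py z≢ny) (grain-other z≢y)))

  module AllOnes (c : Config n) (ones : ∀ z → lookup c z ≡ 1) (u : Fin n) where

    v w : Fin n
    v = next u
    w = next v
    v≢u : v ≢ u
    v≢u = next≢ u
    w≢v : w ≢ v
    w≢v = next≢ v
    w≢u : w ≢ u
    w≢u w≡u = prev≢next u (sym (trans (sym (prev-next v)) (cong prev w≡u)))

    stable-c : Stable c
    stable-c z = subst (_< 3) (sym (ones z)) (s≤s (s≤s z≤n))

    x₁ x₂ x : Config n
    x₁ = c [ w ]≔ 0
    x₂ = x₁ [ u ]≔ 2
    x  = x₂ [ v ]≔ 2

    x-v : lookup x v ≡ 2
    x-v = lookup∘update v x₂ 2
    x-u : lookup x u ≡ 2
    x-u = trans (lookup∘update′ (v≢u ∘ sym) x₂ 2) (lookup∘update u x₁ 2)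
    x-w : lookup x w ≡ 0
    x-w = trans (lookup∘update′ w≢v x₂ 2) (trans (lookup∘update′ w≢u x₁ 2) (lookup∘update w c 0))
    x-other : ∀ {z} → z ≢ v → z ≢ u → z ≢ w → lookup x z ≡ 1
    x-other z≢v z≢u z≢w = trans (lookup∘update′ z≢v x₂ 2)
      (trans (lookup∘update′ z≢u x₁ 2) (trans (lookup∘update′ z≢w c 0) (ones _)))

    stable-x : Stable x
    stable-x z with z ≟ᶠ v | z ≟ᶠ u | z ≟ᶠ w
    ... | yes refl | _        | _        = subst (_< 3) (sym x-v) ≤-refl
    ... | no _     | yes refl | _        = subst (_< 3) (sym x-u) ≤-refl
    ... | no _     | no _     | yes refl = subst (_< 3) (sym x-w) z<s
    ... | no z≢v   | no z≢u   | no z≢w   = subst (_< 3) (sym (x-other z≢v z≢u z≢w)) (s≤s z<s)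

    more : sum c < sum x
    more = ≤-<-trans (≤-trans (≤-reflexive c≡1+x₁) (sum-[]≔-< x₁ (≤-reflexive (cong suc x₁-u))))
                     (sum-[]≔-< x₂ (≤-reflexive (cong suc x₂-v)))
      where
      x₁-u : lookup x₁ u ≡ 1
      x₁-u = trans (lookup∘update′ (w≢u ∘ sym) c 0) (ones u)
      x₂-v : lookup x₂ v ≡ 1
      x₂-v = trans (lookup∘update′ v≢u x₁ 2) (trans (lookup∘update′ (w≢v ∘ sym) c 0) (ones v))
      c≡1+x₁ : sum c ≡ suc (sum x₁)
      c≡1+x₁ = sym (trans (+-comm 1 (sum x₁)) (trans (cong (sum x₁ +_) (sym (ones w)))
                                                     (trans (sum-[]≔ c w 0) (+-identityʳ (sum c)))))

    dominates-x : DominatesOrientation x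
    dominates-x = o , bound
      where
      o : Orientation n
      o = replicate n false [ v ]≔ true
      o-v : lookup o v ≡ true
      o-v = lookup∘update v (replicate n false) true
      o-other : ∀ {z} → z ≢ v → lookup o z ≡ false
      o-other {z} z≢v = trans (lookup∘update′ z≢v (replicate n false) true) (lookup-replicate z false)
      bound : ∀ z → indeg o z ≤ lookup x z
      bound z with z ≟ᶠ v | z ≟ᶠ u | z ≟ᶠ w
      ... | yes refl | _        | _        = subst (indeg o z ≤_) (sym x-v) (indeg≤2 o z)
      ... | no _     | yes refl | _        = subst (indeg o z ≤_) (sym x-u) (indeg≤2 o z)
      ... | no z≢v   | no _     | yes refl =
        ≤-reflexive (trans (indeg≡ o z (o-other z≢v) (trans (cong (lookup o) (prev-next v)) o-v)) (sym x-w))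
      ... | no z≢v   | no z≢u   | no z≢w   =
        ≤-reflexive (trans (indeg≡ o z (o-other z≢v) (o-other pz≢v)) (sym (x-other z≢v z≢u z≢w)))
        where
        pz≢v : prev z ≢ v
        pz≢v pz≡v = z≢w (trans (sym (next-prev z)) (cong next pz≡v))

    c₀ c₁ : Config n
    c₀ = addGrain x u
    c₁ = topple c₀ u false true true

    c₀-u : lookup c₀ u ≡ 3
    c₀-u = trans (addGrain-self x u) (cong (_+ 1) x-u)
    c₁-v : lookup c₁ v ≡ 3
    c₁-v = trans (topple-next c₀ u false true true) (cong (_+ 1) (trans (addGrain-other x u v≢u) x-v))

    c≡c₂ : c ≡ topple c₁ v false true true
    c≡c₂ = vec-ext λ z → sym (at z)
      where
      at : ∀ z → lookup (topple c₁ v false true true) z ≡ lookup c z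
      at z with z ≟ᶠ w | z ≟ᶠ v | z ≟ᶠ u
      ... | yes refl | _        | _        = trans (topple-next c₁ v false true true)
          (trans (cong (_+ 1) (trans (topple-forward-other c₀ u true true w≢u w≢v)
                                     (trans (addGrain-other x u w≢u) x-w))) (sym (ones z)))
      ... | no _     | yes refl | _        = trans (topple-self c₁ v false true true)
          (trans (cong (_∸ 2) c₁-v) (sym (ones z)))
      ... | no z≢w   | no z≢v   | yes refl = trans (topple-forward-other c₁ v true true z≢v z≢w)
          (trans (topple-self c₀ u false true true) (trans (cong (_∸ 2) c₀-u) (sym (ones z))))
      ... | no z≢w   | no z≢v   | no z≢u   = trans (topple-forward-other c₁ v true true z≢v z≢w)
          (trans (topple-forward-other c₀ u true true z≢u z≢v)
          (trans (addGrain-other x u z≢u) (trans (x-other z≢v z≢u z≢w) (sym (ones z)))))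

    steps : Star ToppleStep (addGrain x u) c
    steps = (u , ≤-reflexive (sym c₀-u) , false , true , true , refl) ◅
            (v , ≤-reflexive (sym c₁-v) , false , true , true , c≡c₂) ◅ ε

  ones-predecessor : ∀ c → (∀ z → lookup c z ≡ 1) → Fin n → Predecessor c
  ones-predecessor c ones u = x , stable-x , dominates-x , more , (stable-x , u , steps , stable-c)
    where open AllOnes c ones u

  predecessor : ∀ c → Stable c → DominatesOrientation c → ∀ {y} → lookup c y ≢ 2 → Predecessor c
  predecessor c Sc D {y} cy≢2 with any? (λ i → lookup c i ≟ℕ 2)
  ... | no no-two = ones-predecessor c ones zero
    where
    ones : ∀ z → lookup c z ≡ 1
    ones z with stable-cases (Sc z)
    ... | inj₁ cz≡0        = ⊥-elim (no-two (proj₁ (zeros-closed z cz≡0) , proj₁ (proj₂ (zeros-closed z cz≡0))))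
      where zeros-closed = dominates⇒zerosFollowedByTwos c Sc D
    ... | inj₂ (inj₁ cz≡1) = cz≡1
    ... | inj₂ (inj₂ cz≡2) = ⊥-elim (no-two (z , cz≡2))
  ... | yes (i , ci≡2) with two-before-non-two c ci≡2 cy≢2
  ...   | w , cw≢2 , cpw≡2 with stable-cases (Sc w)
  ...     | inj₂ (inj₂ cw≡2) = ⊥-elim (cw≢2 cw≡2)
  ...     | inj₂ (inj₁ cw≡1) = fire-backward c Sc D w cw≡1 cpw≡2
  ...     | inj₁ cw≡0 with dominates⇒zerosFollowedByTwos c Sc D w cw≡0
  ...       | i′ , ci′≡2 , ones with InOpen-prev {j = w} {i = i′} (inj₁ refl)
  ...         | inj₁ pi′≡w = fire-both c Sc D w cw≡0 cpw≡2
                               (trans (cong (lookup c ∘ next) (sym pi′≡w)) (trans (cong (lookup c) (next-prev i′)) ci′≡2))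
  ...         | inj₂ pi′∈ = fire-forward c Sc D (prev i′) (ones (prev i′) pi′∈)
                              (trans (cong (lookup c) (next-prev i′)) ci′≡2)

  reach-from-maxStable : ∀ c → Stable c → DominatesOrientation c → Reach maxStable c
  reach-from-maxStable = stable-induction (λ c → DominatesOrientation c → Reach maxStable c) step
    where
    step : ∀ c → Stable c → (∀ d → Stable d → sum c < sum d → DominatesOrientation d → Reach maxStable d) →
           DominatesOrientation c → Reach maxStable c
    step c Sc IH D with all? (λ x → lookup c x ≟ℕ 2)
    ... | yes all-two = subst (Reach maxStable) (sym (all-two⇒maxStable c all-two)) ε
    ... | no ¬all-two with ¬∀⟶∃¬ n _ (λ x → lookup c x ≟ℕ 2) ¬all-two
    ...   | _ , cy≢2 with predecessor c Sc D cy≢2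
    ...     | x , Sx , Dx , more , x↝c = IH x Sx more Dx ◅◅ (x↝c ◅ ε)

  recurrent⇒dominates : ∀ {c : Config n} → Recurrent c → DominatesOrientation c
  recurrent⇒dominates {c} (Sc , returns) =
    dominates-reach (returns maxStable (reach-maxStable c Sc)) dominates-maxStable

  dominates⇒recurrent : ∀ {c : Config n} → Stable c → DominatesOrientation c → Recurrent c
  dominates⇒recurrent {c} Sc D =
    Sc , λ d c↝d → reach-maxStable d (stable-reach c↝d Sc) ◅◅ reach-from-maxStable c Sc D

-- From subgraphs to configurations

fromSubgraph : ∀ {n} → Subset n × Subset n → Config n
fromSubgraph (A , E) = tabulate λ q → indeg A q + ind (lookup E (prev q))

fromSubgraph-lookup : ∀ {n} (AE : Subset n × Subset n) q →
                      lookup (fromSubgraph AE) q ≡ indeg (proj₁ AE) q + ind (lookup (proj₂ AE) (prev q))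
fromSubgraph-lookup (A , E) = lookup∘tabulate λ q → indeg A q + ind (lookup E (prev q))

sum-fromSubgraph : ∀ {m} (A E : Subset (suc m)) → sum (fromSubgraph (A , E)) ≡ suc m + ∣ E ∣
sum-fromSubgraph {m} A E = begin
  sum (fromSubgraph (A , E))                          ≡⟨ sum-tabulate (λ q → indeg A q + ind (lookup E (prev q))) ⟩
  ∑ (λ q → indeg A q + ind (lookup E (prev q)))       ≡⟨ ∑-distrib-+ (indeg A) (ind ∘ lookup E ∘ prev) ⟩
  ∑ (indeg A) + ∑ (ind ∘ lookup E ∘ prev)             ≡⟨ cong₂ _+_ (∑-indeg A) (∑-prev (ind ∘ lookup E)) ⟩
  suc m + ∑ (ind ∘ lookup E)                          ≡⟨ cong (suc m +_) (∣p∣≡∑ind E) ⟨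
  suc m + ∣ E ∣                                       ∎
  where open ≡-Reasoning

level≡ : ∀ {n e} (c : Config n) → sum c ≡ n + e → level c ≡ ℤ.+ e
level≡ {n} {e} c sum≡ = begin
  ℤ.+ sum c ℤ.- ℤ.+ n    ≡⟨ cong (λ s → ℤ.+ s ℤ.- ℤ.+ n) sum≡ ⟩
  ℤ.+ (n + e) ℤ.- ℤ.+ n  ≡⟨ ℤ.[+m]-[+n]≡m⊖n (n + e) n ⟩
  (n + e) ℤ.⊖ n          ≡⟨ ℤ.⊖-≥ (m≤m+n n e) ⟩
  ℤ.+ (n + e ∸ n)        ≡⟨ cong ℤ.+_ (m+n∸m≡n n e) ⟩
  ℤ.+ e                  ∎
  where open ≡-Reasoning

-- 01*-chains

module _ {m : ℕ} (c : Config (suc m)) where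

  InChain-value : ∀ {x} → InChain c x → lookup c x ≡ 0 ⊎ lookup c x ≡ 1
  InChain-value (j , cj≡0 , inj₁ refl)        = inj₁ cj≡0
  InChain-value (j , cj≡0 , inj₂ (cx≡1 , _)) = inj₂ cx≡1

  two∉chain : ∀ {x} → lookup c x ≡ 2 → ¬ InChain c x
  two∉chain cx≡2 x∈ with InChain-value x∈
  ... | inj₁ cx≡0 = 0≢1+n (trans (sym cx≡0) cx≡2)
  ... | inj₂ cx≡1 = 0≢1+n (suc-injective (trans (sym cx≡1) cx≡2))

  ones-before⇒InChain-prev : ∀ {j x} → lookup c j ≡ 0 → OnesBetween c j x → InChain c (prev x)
  ones-before⇒InChain-prev {j} {x} cj≡0 ones with prev x ≟ᶠ j
  ... | yes px≡j = j , cj≡0 , inj₁ px≡j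
  ... | no px≢j  = j , cj≡0 , inj₂ (ones (prev x) px∈ , λ y → ones y ∘ InOpen-extend px≢j)
    where
    px∈ : InOpen j x (prev x)
    px∈ with InOpen-prev {j = j} {i = x} (inj₁ refl)
    ... | inj₁ px≡j = ⊥-elim (px≢j px≡j)
    ... | inj₂ px∈′ = px∈′

  InChain-prev⇒ones-before : ∀ {x} → InChain c (prev x) → ∃[ j ] lookup c j ≡ 0 × OnesBetween c j x
  InChain-prev⇒ones-before {x} (j , cj≡0 , px) with prev x ≟ᶠ j | px
  ... | yes px≡j | _                   = j , cj≡0 , λ y y∈ → ⊥-elim (InOpen-empty px≡j y∈)
  ... | no px≢j  | inj₁ px≡j           = ⊥-elim (px≢j px≡j)
  ... | no px≢j  | inj₂ (cpx≡1 , ones) = j , cj≡0 , ones′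
    where
    ones′ : OnesBetween c j x
    ones′ y y∈ with InOpen-init px≢j y∈
    ... | inj₁ refl = cpx≡1
    ... | inj₂ y∈′  = ones y y∈′

  InChain-one⇒InChain-prev : ∀ {x} → lookup c x ≡ 1 → InChain c x → InChain c (prev x)
  InChain-one⇒InChain-prev cx≡1 (j , cj≡0 , inj₁ refl)       = ⊥-elim (0≢1+n (trans (sym cj≡0) cx≡1))
  InChain-one⇒InChain-prev cx≡1 (j , cj≡0 , inj₂ (_ , ones)) = ones-before⇒InChain-prev cj≡0 ones

  InChain-prev⇒InChain-one : ∀ {x} → lookup c x ≡ 1 → InChain c (prev x) → InChain c x
  InChain-prev⇒InChain-one cx≡1 px∈ with InChain-prev⇒ones-before px∈
  ... | j , cj≡0 , ones = j , cj≡0 , inj₂ (cx≡1 , ones)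

  InChain-prev⇒CFM : ∀ {x} → lookup c x ≡ 2 → InChain c (prev x) → CFM c x
  InChain-prev⇒CFM cx≡2 px∈ = cx≡2 , InChain-prev⇒ones-before px∈

  CFM⇒InChain-prev : ∀ {x} → CFM c x → InChain c (prev x)
  CFM⇒InChain-prev (_ , j , cj≡0 , ones) = ones-before⇒InChain-prev cj≡0 ones

  first-non-one-unique : ∀ {j i x} → OnesBetween c j i → OnesBetween c j x →
                         lookup c i ≢ 1 → lookup c x ≢ 1 → i ≢ j → i ≡ x
  first-non-one-unique {j} {i} {x} ones-i ones-x ci≢1 cx≢1 i≢j with i ≟ᶠ x
  ... | yes i≡x = i≡x
  ... | no i≢x with InOpen-trichotomy i≢j i≢x
  ...   | inj₁ i∈ = ⊥-elim (ci≢1 (ones-x i i∈))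
  ...   | inj₂ x∈ = ⊥-elim (cx≢1 (ones-i x x∈))

  zero⇒prev∉chain : ZerosFollowedByTwos c → ∀ {x} → lookup c x ≡ 0 → ¬ InChain c (prev x)
  zero⇒prev∉chain closed {x} cx≡0 px∈ with InChain-prev⇒ones-before px∈
  ... | j , cj≡0 , ones-x with closed j cj≡0
  ...   | i , ci≡2 , ones-i = 0≢1+n (trans (sym cx≡0) (trans (cong (lookup c) (sym i≡x)) ci≡2))
    where
    i≡x : i ≡ x
    i≡x = first-non-one-unique ones-i ones-x (λ ci≡1 → 1+n≢0 (suc-injective (trans (sym ci≡2) ci≡1)))
            (λ cx≡1 → 0≢1+n (trans (sym cx≡0) cx≡1)) (λ { refl → 0≢1+n (trans (sym cj≡0) ci≡2) })

  chainOrientation : Orientation (suc m)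
  chainOrientation = tabulate λ q → not (does (inChain? c q))

  chainOrientation-lookup : ∀ q → lookup chainOrientation q ≡ not (does (inChain? c q))
  chainOrientation-lookup = lookup∘tabulate λ q → not (does (inChain? c q))

  chainOrientation-∉ : ∀ {q} → ¬ InChain c q → lookup chainOrientation q ≡ true
  chainOrientation-∉ {q} q∉ = trans (chainOrientation-lookup q) (cong not (dec-false (inChain? c q) q∉))

  chainOrientation-∈ : ∀ {q} → InChain c q → lookup chainOrientation q ≡ false
  chainOrientation-∈ {q} q∈ = trans (chainOrientation-lookup q) (cong not (dec-true (inChain? c q) q∈))

  mconf-lookup : ∀ q → lookup (mconf c) q ≡
                       (if does (lookup c q ≟ℕ 0) then 0 else (if does (cfm? c q) then 2 else 1))
  mconf-lookup = lookup∘tabulate λ q → if does (lookup c q ≟ℕ 0) then 0 else (if does (cfm? c q) then 2 else 1)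

  mconf-zero : ∀ {q} → lookup c q ≡ 0 → lookup (mconf c) q ≡ 0
  mconf-zero {q} cq≡0 rewrite mconf-lookup q | dec-true (lookup c q ≟ℕ 0) cq≡0 = refl

  mconf-cfm : ∀ {q} → CFM c q → lookup (mconf c) q ≡ 2
  mconf-cfm {q} q-cfm
    rewrite mconf-lookup q | dec-false (lookup c q ≟ℕ 0) (λ cq≡0 → 0≢1+n (trans (sym cq≡0) (proj₁ q-cfm)))
          | dec-true (cfm? c q) q-cfm = refl

  mconf-other : ∀ {q} → lookup c q ≢ 0 → ¬ CFM c q → lookup (mconf c) q ≡ 1
  mconf-other {q} cq≢0 q-¬cfm
    rewrite mconf-lookup q | dec-false (lookup c q ≟ℕ 0) cq≢0 | dec-false (cfm? c q) q-¬cfm = refl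

  indeg-chainOrientation : Stable c → ZerosFollowedByTwos c → ∀ q → indeg chainOrientation q ≡ lookup (mconf c) q
  indeg-chainOrientation Sc closed q with lookup c q ≟ℕ 0 | cfm? c q
  ... | yes cq≡0 | _ = trans (indeg≡ chainOrientation q (chainOrientation-∈ (q , cq≡0 , inj₁ refl))
                                                      (chainOrientation-∉ (zero⇒prev∉chain closed cq≡0)))
                             (sym (mconf-zero cq≡0))
  ... | no _     | yes q-cfm = trans (indeg≡ chainOrientation q (chainOrientation-∉ (two∉chain (proj₁ q-cfm)))
                                                              (chainOrientation-∈ (CFM⇒InChain-prev q-cfm)))
                                     (sym (mconf-cfm q-cfm))
  ... | no cq≢0  | no q-¬cfm = trans (indeg-one (inChain? c q)) (sym (mconf-other cq≢0 q-¬cfm))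
    where
    prev∈⇒∈ : InChain c (prev q) → InChain c q
    prev∈⇒∈ px∈ with stable-cases (Sc q)
    ... | inj₁ cq≡0        = ⊥-elim (cq≢0 cq≡0)
    ... | inj₂ (inj₁ cq≡1) = InChain-prev⇒InChain-one cq≡1 px∈
    ... | inj₂ (inj₂ cq≡2) = ⊥-elim (q-¬cfm (InChain-prev⇒CFM cq≡2 px∈))
    indeg-one : Dec (InChain c q) → indeg chainOrientation q ≡ 1
    indeg-one (yes q∈) = indeg≡ chainOrientation q (chainOrientation-∈ q∈) (chainOrientation-∈ prev∈)
      where
      prev∈ : InChain c (prev q)
      prev∈ with InChain-value q∈
      ... | inj₁ cq≡0 = ⊥-elim (cq≢0 cq≡0)
      ... | inj₂ cq≡1 = InChain-one⇒InChain-prev cq≡1 q∈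
    indeg-one (no q∉)  = indeg≡ chainOrientation q (chainOrientation-∉ q∉) (chainOrientation-∉ (q∉ ∘ prev∈⇒∈))

  𝒪-mconf : Stable c → ZerosFollowedByTwos c → 𝒪 (mconf c) ≡ chainOrientation
  𝒪-mconf Sc closed with any? (λ j → lookup c j ≟ℕ 0)
  ... | no no-zero = trans (cong 𝒪 mconf≡ones) (trans 𝒪-ones (sym all-true))
    where
    mconf≡ones : mconf c ≡ replicate (suc m) 1
    mconf≡ones = vec-ext λ q →
      trans (mconf-other (λ cq≡0 → no-zero (q , cq≡0)) (λ (_ , j , cj≡0 , _) → no-zero (j , cj≡0)))
            (sym (lookup-replicate q 1))
    all-true : chainOrientation ≡ replicate (suc m) true
    all-true = vec-ext λ q → trans (chainOrientation-∉ {q} (λ (j , cj≡0 , _) → no-zero (j , cj≡0)))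
                                   (sym (lookup-replicate q true))
  ... | yes (j , cj≡0) = 𝒪-unique (mconf c) mconf≢ones has-chainOrientation unique
    where
    has-chainOrientation : HasIndegrees (mconf c) chainOrientation
    has-chainOrientation = vec-ext λ q → trans (lookup∘tabulate (indeg chainOrientation) q) (indeg-chainOrientation Sc closed q)
    mconf≢ones : mconf c ≢ replicate (suc m) 1
    mconf≢ones eq = 0≢1+n (trans (sym (mconf-zero cj≡0)) (trans (cong (λ v → lookup v j) eq) (lookup-replicate j 1)))
    clockwise-at-j : ∀ o → HasIndegrees (mconf c) o → lookup o j ≡ false
    clockwise-at-j o has = proj₁ (indeg≤0⇒ o j (≤-reflexive (trans (HasIndegrees⇒indeg≡ o has j) (mconf-zero cj≡0))))
    unique : ∀ o → HasIndegrees (mconf c) o → o ≡ chainOrientation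
    unique o has = indeg-determines o chainOrientation j
      (λ q → trans (HasIndegrees⇒indeg≡ o has q) (sym (HasIndegrees⇒indeg≡ chainOrientation has-chainOrientation q)))
      (trans (clockwise-at-j o has) (sym (clockwise-at-j chainOrientation has-chainOrientation)))

  G-isSubgraph : Stable c → ZerosFollowedByTwos c → IsSubgraph (G c)
  G-isSubgraph Sc closed = subst (λ A → IsSubgraph (A , proj₂ (G c))) (sym (𝒪-mconf Sc closed)) (nonempty , edges)
    where
    ∉chain⇒∈ : ∀ {q} → ¬ InChain c q → q ∈ chainOrientation
    ∉chain⇒∈ {q} q∉ = lookup⇒[]= q chainOrientation (chainOrientation-∉ q∉)

    nonempty : Nonempty chainOrientation
    nonempty with any? (λ j → lookup c j ≟ℕ 0)
    ... | yes (j , cj≡0) = let (i , ci≡2 , _) = closed j cj≡0 in i , ∉chain⇒∈ (two∉chain ci≡2)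
    ... | no no-zero     = zero , ∉chain⇒∈ λ (j , cj≡0 , _) → no-zero (j , cj≡0)

    M-head : ∀ {e} → e ∈ proj₂ (G c) → InM c (next e)
    M-head {e} e∈ = does≡true⇒ (inM? c (next e))
      (trans (sym (lookup∘tabulate (λ e → does (inM? c (next e))) e)) ([]=⇒lookup e∈))

    edges : ∀ e → e ∈ proj₂ (G c) → e ∈ chainOrientation × next e ∈ chainOrientation
    edges e e∈ with M-head e∈
    ... | cne≡2 , ¬cfm =
      ∉chain⇒∈ (λ e∈chain → ¬cfm (InChain-prev⇒CFM cne≡2 (subst (InChain c) (sym (prev-next e)) e∈chain))) ,
      ∉chain⇒∈ (two∉chain cne≡2)

  weight01-𝒪 : Stable c → ZerosFollowedByTwos c → weight01 c ≡ ∣ ∁ (𝒪 (mconf c)) ∣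
  weight01-𝒪 Sc closed = cong ∣_∣ (vec-ext {v = ∁ (𝒪 (mconf c))} λ q → begin
    lookup (tabulate λ v → does (inChain? c v)) q  ≡⟨ lookup∘tabulate (λ v → does (inChain? c v)) q ⟩
    does (inChain? c q)                            ≡⟨ not-involutive (does (inChain? c q)) ⟨
    not (not (does (inChain? c q)))                ≡⟨ cong not (chainOrientation-lookup q) ⟨
    not (lookup chainOrientation q)                ≡⟨ lookup-map q not chainOrientation ⟨
    lookup (∁ chainOrientation) q                  ≡⟨ cong (λ o → lookup (∁ o) q) (𝒪-mconf Sc closed) ⟨
    lookup (∁ (𝒪 (mconf c))) q                     ∎)
    where open ≡-Reasoning

  mconf+M : Stable c → ∀ q → lookup (mconf c) q + ind (does (inM? c q)) ≡ lookup c q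
  mconf+M Sc q with stable-cases (Sc q)
  ... | inj₁ cq≡0 rewrite mconf-zero cq≡0 | dec-false (inM? c q) (λ (cq≡2 , _) → 0≢1+n (trans (sym cq≡0) cq≡2))
    = sym cq≡0
  ... | inj₂ (inj₁ cq≡1) rewrite mconf-other (λ cq≡0 → 0≢1+n (trans (sym cq≡0) cq≡1))
                                              (λ (cq≡2 , _) → 0≢1+n (suc-injective (trans (sym cq≡1) cq≡2)))
                               | dec-false (inM? c q) (λ (cq≡2 , _) → 0≢1+n (suc-injective (trans (sym cq≡1) cq≡2)))
    = sym cq≡1
  ... | inj₂ (inj₂ cq≡2) with cfm? c q
  ...   | yes q-cfm rewrite mconf-cfm q-cfm | dec-false (inM? c q) (λ (_ , q-¬cfm) → q-¬cfm q-cfm) = sym cq≡2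
  ...   | no q-¬cfm rewrite mconf-other (λ cq≡0 → 0≢1+n (trans (sym cq≡0) cq≡2)) q-¬cfm
                          | dec-true (inM? c q) (cq≡2 , q-¬cfm) = sym cq≡2

  fromSubgraph-G : Stable c → ZerosFollowedByTwos c → fromSubgraph (G c) ≡ c
  fromSubgraph-G Sc closed = vec-ext λ q → begin
    lookup (fromSubgraph (G c)) q                                                  ≡⟨ fromSubgraph-lookup (G c) q ⟩
    indeg (𝒪 (mconf c)) q + ind (lookup (tabulate λ e → does (inM? c (next e))) (prev q))
      ≡⟨ cong₂ (λ o b → indeg o q + ind b) (𝒪-mconf Sc closed)
               (lookup∘tabulate (λ e → does (inM? c (next e))) (prev q)) ⟩
    indeg chainOrientation q + ind (does (inM? c (next (prev q))))
      ≡⟨ cong₂ (λ d x → d + ind (does (inM? c x))) (indeg-chainOrientation Sc closed q) (next-prev q) ⟩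
    lookup (mconf c) q + ind (does (inM? c q))                                    ≡⟨ mconf+M Sc q ⟩
    lookup c q                                                                     ∎
    where open ≡-Reasoning

module _ {m : ℕ} {A E : Subset (suc m)} (subgraph : IsSubgraph (A , E)) where

  private
    c : Config (suc m)
    c = fromSubgraph (A , E)

    value : ∀ {q a pa e} → lookup A q ≡ a → lookup A (prev q) ≡ pa → lookup E (prev q) ≡ e →
            lookup c q ≡ ind a + ind¬ pa + ind e
    value {q} Aq Apq Epq = trans (fromSubgraph-lookup (A , E) q) (cong₂ _+_ (indeg≡ A q Aq Apq) (cong ind Epq))

    edge-ends : ∀ {e} → lookup E e ≡ true → lookup A e ≡ true × lookup A (next e) ≡ true
    edge-ends {e} Ee with proj₂ subgraph e (lookup⇒[]= e E Ee)
    ... | e∈A , ne∈A = []=⇒lookup e∈A , []=⇒lookup ne∈A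

    no-edge-into : ∀ {q} → lookup A q ≡ false → lookup E (prev q) ≡ false
    no-edge-into {q} Aq with lookup E (prev q) in Epq
    ... | false = refl
    ... | true  = ⊥-elim (true≢false (trans (sym (proj₂ (edge-ends Epq))) (trans (cong (lookup A) (next-prev q)) Aq)))

    zero⇒∉A : ∀ {x} → lookup c x ≡ 0 → lookup A x ≡ false
    zero⇒∉A {x} cx≡0 with lookup A x in Ax
    ... | false = refl
    ... | true  = ⊥-elim (0≢1+n (trans (sym cx≡0) (value Ax refl refl)))

    one-after-∉A : ∀ {x} → lookup A (prev x) ≡ false → lookup c x ≡ 1 → lookup A x ≡ false
    one-after-∉A {x} Apx cx≡1 with lookup A x in Ax
    ... | false = refl
    ... | true  = ⊥-elim (0≢1+n (suc-injective (trans (sym cx≡1) (value Ax Apx refl))))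

  fromSubgraph-stable : Stable c
  fromSubgraph-stable q with lookup E (prev q) in Epq
  ... | false = subst (_< 3) (sym (trans (fromSubgraph-lookup (A , E) q) (cong (indeg A q +_) (cong ind Epq))))
                      (s≤s (≤-trans (≤-reflexive (+-identityʳ _)) (indeg≤2 A q)))
  ... | true  = subst (_< 3) (sym (value Aq (proj₁ (edge-ends Epq)) Epq)) ≤-refl
    where
    Aq : lookup A q ≡ true
    Aq = trans (cong (lookup A) (sym (next-prev q))) (proj₂ (edge-ends Epq))

  fromSubgraph-dominates : DominatesOrientation c
  fromSubgraph-dominates = A , λ q → subst (indeg A q ≤_) (sym (fromSubgraph-lookup (A , E) q)) (m≤m+n _ _)

  ∉A⇒InChain : ∀ q → lookup A q ≡ false → InChain c q
  ∉A⇒InChain = cyclic-induction (λ q → lookup A q ≡ false → InChain c q) a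
    (λ Aa≡false → ⊥-elim (true≢false (trans (sym Aa≡true) Aa≡false))) step
    where
    a = proj₁ (proj₁ subgraph)
    Aa≡true : lookup A a ≡ true
    Aa≡true = []=⇒lookup (proj₂ (proj₁ subgraph))
    step : ∀ q → q ≢ a → (lookup A (prev q) ≡ false → InChain c (prev q)) → lookup A q ≡ false → InChain c q
    step q _ IH Aq with lookup A (prev q) in Apq
    ... | true  = q , value Aq Apq (no-edge-into Aq) , inj₁ refl
    ... | false = InChain-prev⇒InChain-one c (value Aq Apq (no-edge-into Aq)) (IH refl)

  InChain⇒∉A : ∀ {q} → InChain c q → lookup A q ≡ false
  InChain⇒∉A (j , cj≡0 , inj₁ refl)           = zero⇒∉A cj≡0
  InChain⇒∉A {q} (j , cj≡0 , inj₂ (cq≡1 , ones)) =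
    one-after-∉A (before-q (prev q) (InOpen-prev (inj₁ refl))) cq≡1
    where
    before-q : ∀ x → x ≡ j ⊎ InOpen j q x → lookup A x ≡ false
    before-q = interval-induction (λ x → lookup A x ≡ false) (zero⇒∉A cj≡0)
                                  (λ x x∈ Apx → one-after-∉A Apx (ones x x∈))

  chainOrientation≡A : chainOrientation c ≡ A
  chainOrientation≡A = vec-ext λ q → on-q q
    where
    on-q : ∀ q → lookup (chainOrientation c) q ≡ lookup A q
    on-q q with lookup A q in Aq
    ... | true  = chainOrientation-∉ c λ q∈ → true≢false (trans (sym Aq) (InChain⇒∉A q∈))
    ... | false = chainOrientation-∈ c (∉A⇒InChain q Aq)

  M-edges≡E : tabulate (λ e → does (inM? c (next e))) ≡ E
  M-edges≡E = vec-ext λ e → trans (lookup∘tabulate (λ e → does (inM? c (next e))) e) (on-e e)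
    where
    on-e : ∀ e → does (inM? c (next e)) ≡ lookup E e
    on-e e with lookup E e in Ee
    ... | true  = dec-true (inM? c (next e)) (cq≡2 , ¬cfm)
      where
      Ae : lookup A (prev (next e)) ≡ true
      Ae = trans (cong (lookup A) (prev-next e)) (proj₁ (edge-ends Ee))
      cq≡2 : lookup c (next e) ≡ 2
      cq≡2 = value (proj₂ (edge-ends Ee)) Ae (trans (cong (lookup E) (prev-next e)) Ee)
      ¬cfm : ¬ CFM c (next e)
      ¬cfm cfm = true≢false (trans (sym Ae) (InChain⇒∉A (CFM⇒InChain-prev c cfm)))
    ... | false = dec-false (inM? c (next e)) λ (cq≡2 , ¬cfm) → ¬cfm (InChain-prev⇒CFM c cq≡2
                    (∉A⇒InChain (prev (next e)) (prev∉A cq≡2)))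
      where
      Epe : lookup E (prev (next e)) ≡ false
      Epe = trans (cong (lookup E) (prev-next e)) Ee
      prev∉A : lookup c (next e) ≡ 2 → lookup A (prev (next e)) ≡ false
      prev∉A cq≡2 with lookup A (prev (next e)) in Ape
      ... | false = refl
      ... | true  = ⊥-elim (two≢≤1 (trans (sym cq≡2) (value {next e} refl Ape Epe)))
        where
        two≢≤1 : ∀ {a} → 2 ≢ ind a + 0 + 0
        two≢≤1 {true} ()
        two≢≤1 {false} ()

  G-fromSubgraph : G c ≡ (A , E)
  G-fromSubgraph = cong₂ _,_ (trans (𝒪-mconf c fromSubgraph-stable closed) chainOrientation≡A) M-edges≡E
    where
    closed = dominates⇒zerosFollowedByTwos c fromSubgraph-stable fromSubgraph-dominates

open import Data.Integer using (+_)

theorem3p10 : (n : ℕ) → 3 ≤ n →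
    ((c : Config n) → Recurrent c → IsSubgraph (G c))
    × ((c c′ : Config n) → Recurrent c → Recurrent c′ → G c ≡ G c′ → c ≡ c′)
    × ((A E : Subset n) → IsSubgraph (A , E) → ∃ λ c → Recurrent c × G c ≡ (A , E))
    × ((c : Config n) → Recurrent c →
         level c ≡ + ∣ proj₂ (G c) ∣ × weight01 c ≡ ∣ ∁ (proj₁ (G c)) ∣)
theorem3p10 0 ()
theorem3p10 1 (s≤s ())
theorem3p10 2 (s≤s (s≤s ()))
theorem3p10 (suc (suc (suc k))) _ = G-subgraph , G-injective , G-surjective , counts
  where
  closed : ∀ {c : Config (3 + k)} → Recurrent c → ZerosFollowedByTwos c
  closed {c} R = dominates⇒zerosFollowedByTwos c (proj₁ R) (recurrent⇒dominates R)

  reconstruct : ∀ {c : Config (3 + k)} → Recurrent c → fromSubgraph (G c) ≡ c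
  reconstruct {c} R = fromSubgraph-G c (proj₁ R) (closed R)

  G-subgraph : (c : Config (3 + k)) → Recurrent c → IsSubgraph (G c)
  G-subgraph c R = G-isSubgraph c (proj₁ R) (closed R)

  G-injective : (c c′ : Config (3 + k)) → Recurrent c → Recurrent c′ → G c ≡ G c′ → c ≡ c′
  G-injective c c′ R R′ G≡ = trans (sym (reconstruct R)) (trans (cong fromSubgraph G≡) (reconstruct R′))

  G-surjective : (A E : Subset (3 + k)) → IsSubgraph (A , E) → ∃ λ c → Recurrent c × G c ≡ (A , E)
  G-surjective A E sub = fromSubgraph (A , E) ,
    dominates⇒recurrent (fromSubgraph-stable sub) (fromSubgraph-dominates sub) , G-fromSubgraph sub

  counts : (c : Config (3 + k)) → Recurrent c →
           level c ≡ + ∣ proj₂ (G c) ∣ × weight01 c ≡ ∣ ∁ (proj₁ (G c)) ∣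
  counts c R = level≡ c (trans (cong sum (sym (reconstruct R))) (sum-fromSubgraph (proj₁ (G c)) (proj₂ (G c)))) ,
               weight01-𝒪 c (proj₁ R) (closed R)
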